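{- Let $k,n$ be positive integers, $m=(n-1)k+1$, and let $\mathcal{G}$ and $\mathcal{N}$ be as defined in the context. Identify each element $x\in\mathcal{G}$ other than the maximal partition with the vertex of $\mathcal{T}^k_n$ given by the rooted tree with a single non-root internal vertex whose set of leaves below it is the non-singleton block of $x$. With this identification, $\mathcal{N}=\mathcal{T}^k_n$ as simplicial complexes.
   Context: $\Pi_m$ is the lattice of set partitions of $\{1,\dots,m\}$ ordered by refinement, $\mathrm{rk}(x)=m-(\text{number of blocks of }x)$, and $\Pi^{(k)}_m\subseteq\Pi_m$ is the subposet of partitions with all block sizes congruent to $1$ modulo $k$. $\mathcal{I}$ is the set of partitions with exactly one block of size larger than $1$, and $\mathcal{G}=\{x\in\mathcal{I}\mid\mathrm{rk}(x)\equiv0\pmod k\}\subseteq\Pi^{(k)}_m$. For $x_1,\dots,x_\ell\in\Pi^{(k)}_m$ say that their join exists uniquely in $\Pi^{(k)}_m$ if $\{x_1,\dots,x_\ell\}$ has exactly one minimal upper bound in $\Pi^{(k)}_m$, and then write $x_1\vee^k\dots\vee^k x_\ell$ for it. $\mathcal{N}$ is the family of all nonempty subsets $N\subseteq\mathcal{G}$, not containing the maximal partition, such that for every set $\{x_1,\dots,x_\ell\}\subseteq N$ of $\ell\ge2$ pairwise incomparable elements, the join $x_1\vee^k\dots\vee^k x_\ell$ exists uniquely and is not in $\mathcal{G}$. $\mathcal{T}^k_n$ is the abstract simplicial complex whose faces are combinatorial types of rooted trees with $m$ leaves labelled $1,\dots,m$ with all internal outdegrees larger than $1$ and congruent to $1$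 modulo $k$, where $T_2$ is a face of $T_1$ iff $T_2$ is obtained from $T_1$ by contracting internal edges; a tree is identified with the set of leaf-sets $\ell(t)$ below its non-root internal vertices $t$. -}

module Defs where

open import Data.Nat using (ℕ; zero; suc; _+_; _∸_; _<_; _≤_; _<ᵇ_; _≡ᵇ_; NonZero)
open import Data.Nat.DivMod using (_%_)
open import Data.Bool using (Bool; true; false; if_then_else_; _∧_; _∨_; not)
open import Data.Fin using (Fin; toℕ; _≟_)
import Data.Fin as F
open import Data.List using (List; []; _∷_; length)
open import Data.List.Relation.Unary.All using (All)
open import Data.List.Relation.Unary.Any using (Any)
open import Data.List.Relation.Unary.AllPairs using (AllPairs)
open import Data.List.Relation.Binary.Permutation.Propositional using (_↭_)
open import Data.List using (allFin)
open import Data.Product using (Σ; ∃; _×_)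
open import Relation.Nullary using (¬_; does)
open import Relation.Binary.PropositionalEquality using (_≡_)

countB : ∀ {m} → (Fin m → Bool) → ℕ
countB {zero}  f = 0
countB {suc m} f = (if f F.zero then 1 else 0) + countB (λ i → f (F.suc i))

_≡[mod_]_ : ℕ → (k : ℕ) → .{{NonZero k}} → ℕ → Set
a ≡[mod k ] b = a % k ≡ b % k

-- Set partitions of Fin m, as (Boolean) equivalence relations:
-- rel i j = true  iff  i and j lie in the same block.

BRel : ℕ → Set
BRel m = Fin m → Fin m → Bool

record IsPartition {m : ℕ} (r : BRel m) : Set where
  field
    reflP  : ∀ i → r i i ≡ true
    symP   : ∀ i j → r i j ≡ true → r j i ≡ true
    transP : ∀ i j l → r i j ≡ true → r j l ≡ true → r i l ≡ true

record Partition (m : ℕ) : Set where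
  constructor mkPartition
  field
    rel     : BRel m
    isPart  : IsPartition rel
open Partition public

_≈ᴿ_ : ∀ {m} → BRel m → BRel m → Set
r ≈ᴿ s = ∀ i j → r i j ≡ s i j

_≈_ : ∀ {m} → Partition m → Partition m → Set
x ≈ y = rel x ≈ᴿ rel y

_⊑_ : ∀ {m} → Partition m → Partition m → Set
x ⊑ y = ∀ i j → rel x i j ≡ true → rel y i j ≡ true

Incomparable : ∀ {m} → Partition m → Partition m → Set
Incomparable x y = ¬ (x ⊑ y) × ¬ (y ⊑ x)

blockSize : ∀ {m} → Partition m → Fin m → ℕ
blockSize x i = countB (λ j → rel x i j)

isRep : ∀ {m} → Partition m → Fin m → Bool
isRep x i = countB (λ j → (toℕ j <ᵇ toℕ i) ∧ rel x i j) ≡ᵇ 0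

numBlocks : ∀ {m} → Partition m → ℕ
numBlocks x = countB (isRep x)

rk : ∀ {m} → Partition m → ℕ
rk {m} x = m ∸ numBlocks x

IsMax : ∀ {m} → Partition m → Set
IsMax x = ∀ i j → rel x i j ≡ true

InPiK : ∀ {m} (k : ℕ) → .{{NonZero k}} → Partition m → Set
InPiK k x = ∀ i → blockSize x i ≡[mod k ] 1

InI : ∀ {m} → Partition m → Set
InI x = countB (λ i → isRep x i ∧ (1 <ᵇ blockSize x i)) ≡ 1

InG : ∀ {m} (k : ℕ) → .{{NonZero k}} → Partition m → Set
InG k x = InI x × rk x ≡[mod k ] 0

_∈ᴾ_ : ∀ {m} → Partition m → List (Partition m) → Set
x ∈ᴾ N = Any (x ≈_) N

UpperBound : ∀ {m} (k : ℕ) → .{{NonZero k}} → List (Partition m) → Partition m → Set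
UpperBound k xs u = InPiK k u × All (_⊑ u) xs

MinimalUpperBound : ∀ {m} (k : ℕ) → .{{NonZero k}} → List (Partition m) → Partition m → Set
MinimalUpperBound k xs u =
  UpperBound k xs u × (∀ v → UpperBound k xs v → v ⊑ u → v ≈ u)

-- the join x₁ ∨ᵏ … ∨ᵏ xₗ exists uniquely in Π^(k)_m and equals j
IsUniqueJoin : ∀ {m} (k : ℕ) → .{{NonZero k}} → List (Partition m) → Partition m → Set
IsUniqueJoin k xs j =
  MinimalUpperBound k xs j × (∀ u → MinimalUpperBound k xs u → u ≈ j)

InN : ∀ {m} (k : ℕ) → .{{NonZero k}} → List (Partition m) → Set
InN k N =
  ¬ (N ≡ [])
  × All (InG k) N
  × All (λ x → ¬ IsMax x) N
  × (∀ (xs : List _) → 2 ≤ length xs → All (_∈ᴾ N) xs → AllPairs Incomparable xs →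
       Σ _ (λ j → IsUniqueJoin k xs j × ¬ InG k j))

data Tree (m : ℕ) : Set where
  leaf : Fin m → Tree m
  node : List (Tree m) → Tree m

mutual
  leaves : ∀ {m} → Tree m → List (Fin m)
  leaves (leaf i)  = i ∷ []
  leaves (node ts) = leavesL ts

  leavesL : ∀ {m} → List (Tree m) → List (Fin m)
  leavesL []       = []
  leavesL (t ∷ ts) = Data.List._++_ (leaves t) (leavesL ts)

mutual
  internalSets : ∀ {m} → Tree m → List (List (Fin m))
  internalSets (leaf i)  = []
  internalSets (node ts) = leavesL ts ∷ internalSetsL ts

  internalSetsL : ∀ {m} → List (Tree m) → List (List (Fin m))
  internalSetsL []       = []
  internalSetsL (t ∷ ts) = Data.List._++_ (internalSets t) (internalSetsL ts)

-- leaf sets of the non-root internal vertices: the face of 𝓣 given by the tree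
nonRootSets : ∀ {m} → Tree m → List (List (Fin m))
nonRootSets (leaf i)  = []
nonRootSets (node ts) = internalSetsL ts

mutual
  ValidDeg : ∀ {m} (k : ℕ) → .{{NonZero k}} → Tree m → Set
  ValidDeg k (leaf i)  = Data.Unit.⊤
    where import Data.Unit
  ValidDeg k (node ts) = (1 < length ts) × (length ts ≡[mod k ] 1) × ValidDegL k ts

  ValidDegL : ∀ {m} (k : ℕ) → .{{NonZero k}} → List (Tree m) → Set
  ValidDegL k []       = Data.Unit.⊤
    where import Data.Unit
  ValidDegL k (t ∷ ts) = ValidDeg k t × ValidDegL k ts

ValidTree : ∀ {m} (k : ℕ) → .{{NonZero k}} → Tree m → Set
ValidTree {m} k T = (leaves T ↭ allFin m) × ValidDeg k T

-- The identification: a leaf set L (a vertex of 𝓣) ↦ the partition whose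
-- only non-singleton block is L.

memB : ∀ {m} → Fin m → List (Fin m) → Bool
memB i []       = false
memB i (j ∷ js) = does (i ≟ j) ∨ memB i js

ιRel : ∀ {m} → List (Fin m) → BRel m
ιRel L i j = does (i ≟ j) ∨ (memB i L ∧ memB j L)

-- For one-block partitions, x ≤ y iff the block of x is contained in the block of y. Pairwise
-- incomparable elements with pairwise disjoint blocks have as unique join in Π^(k)_m the
-- partition with exactly these blocks, which has several nontrivial blocks and so is not in 𝓖;
-- two elements with overlapping blocks have a minimal upper bound lying in 𝓖. Hence N ∈ 𝓝 iff
-- the blocks of N form a laminar family of proper subsets of sizes ≡ 1 mod k, and these are
-- exactly the families of leaf sets of non-root vertices of trees in 𝓣^k_n: the number of
-- leaves below a vertex is congruent to its outdegree modulo k, and conversely a tree is built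
-- from a laminar family by inserting its sets in order of increasing size.

module Submission where

open import Defs

open import Algebra.Properties.CommutativeSemigroup using (interchange)
open import Data.Bool using (Bool; true; false; if_then_else_; _∧_; _∨_; not)
open import Data.Bool.Properties
  using (∨-assoc; ∨-identityʳ; ∧-zeroʳ; ∧-conicalˡ; ∧-conicalʳ; not-¬; ¬-not; not-injective;
         ⇔→≡; T-≡)
open import Data.Empty using (⊥; ⊥-elim)
open import Data.Fin using (Fin; toℕ; _≟_)
import Data.Fin as F
open import Data.Fin.Properties using (toℕ-injective)
open import Data.List using (List; []; _∷_; length; _++_; map; allFin; filter; filterᵇ)
open import Data.List.Properties using (length-++; length-map; ++-assoc; length-tabulate)
open import Data.List.Membership.Propositional using (_∈_; _∉_; find; lose)
open import Data.List.Membership.Propositional.Properties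
  using (∈-allFin; ∈-map⁺; ∈-map⁻; ∈-++⁺ˡ; ∈-++⁺ʳ; ∈-++⁻; ∈-filter⁺; ∈-filter⁻)
open import Data.List.Relation.Unary.All using (All; []; _∷_)
import Data.List.Relation.Unary.All as All
import Data.List.Relation.Unary.All.Properties as All
open import Data.List.Relation.Unary.AllPairs using (AllPairs; []; _∷_)
open import Data.List.Relation.Unary.Any using (Any; here; there)
import Data.List.Relation.Unary.Any as Any
open import Data.List.Relation.Unary.Unique.Propositional using (Unique)
import Data.List.Relation.Unary.Unique.Propositional.Properties as Unique
open import Data.List.Relation.Binary.Permutation.Propositional
  using (_↭_; ↭-sym; ↭-trans; ↭-refl; ↭⇒↭ₛ)
open import Data.List.Relation.Binary.Permutation.Propositional.Properties
  using (∈-resp-↭; ++⁺ˡ; shifts; ↭-length)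
import Data.List.Relation.Binary.Permutation.Setoid.Properties as PermutationSetoid
import Data.Nat as ℕ
open import Data.Nat using (ℕ; zero; suc; _+_; _*_; _∸_; _<_; _≤_; _<ᵇ_; _≡ᵇ_; _%_; NonZero; z≤n; s≤s)
open import Data.Nat.Properties hiding (_≟_)
open import Data.Nat.DivMod using (%-distribˡ-+; [m+n]%n≡m%n; [m+kn]%n≡m%n)
open import Data.Product using (Σ; _×_; _,_; proj₁; proj₂)
open import Data.Sum using (_⊎_; inj₁; inj₂)
open import Data.Unit using (tt)
open import Function using (_∘_)
open import Function.Bundles using (_⇔_; mk⇔; Equivalence)
open import Relation.Binary.Definitions using (tri<; tri≈; tri>)
open import Relation.Binary.PropositionalEquality
open import Relation.Nullary using (¬_; Dec; does; yes; no; ¬?)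
open import Relation.Nullary.Decidable using (dec-true; dec-false)

private
  variable
    m : ℕ

∨-introˡ : ∀ {a b} → a ≡ true → a ∨ b ≡ true
∨-introˡ refl = refl

∨-introʳ : ∀ a {b} → b ≡ true → a ∨ b ≡ true
∨-introʳ true  _ = refl
∨-introʳ false p = p

∨-elim : ∀ a {b} → a ∨ b ≡ true → a ≡ true ⊎ b ≡ true
∨-elim true  _ = inj₁ refl
∨-elim false p = inj₂ p

∧-intro : ∀ {a b} → a ≡ true → b ≡ true → a ∧ b ≡ true
∧-intro refl refl = refl

≡true-ext : ∀ {a b} → (a ≡ true → b ≡ true) → (b ≡ true → a ≡ true) → a ≡ b
≡true-ext f g = ⇔→≡ (mk⇔ f g)

eqB : Fin m → Fin m → Bool
eqB i j = does (i ≟ j)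

eqB-refl : (i : Fin m) → eqB i i ≡ true
eqB-refl i = dec-true (i ≟ i) refl

eqB-≢ : {i j : Fin m} → ¬ i ≡ j → eqB i j ≡ false
eqB-≢ {i = i} {j} = dec-false (i ≟ j)

eqB⇒≡ : {i j : Fin m} → eqB i j ≡ true → i ≡ j
eqB⇒≡ {i = i} {j} p with i ≟ j | p
... | yes i≡j | _  = i≡j
... | no _    | ()

eqB-sym : (i j : Fin m) → eqB i j ≡ eqB j i
eqB-sym i j = ≡true-ext (λ p → subst (λ l → eqB l i ≡ true) (eqB⇒≡ {i = i} {j} p) (eqB-refl i))
                        (λ p → subst (λ l → eqB l j ≡ true) (eqB⇒≡ {i = j} {i} p) (eqB-refl j))

eqB-suc : (i j : Fin m) → eqB (F.suc i) (F.suc j) ≡ eqB i j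
eqB-suc i j with i ≟ j
... | yes _ = refl
... | no _  = refl

indicator : Bool → ℕ
indicator b = if b then 1 else 0

countB-cong : {f g : Fin m → Bool} → (∀ i → f i ≡ g i) → countB f ≡ countB g
countB-cong {zero}  e = refl
countB-cong {suc m} e = cong₂ (λ a b → indicator a + b) (e F.zero) (countB-cong (e ∘ F.suc))

indicator-mono : ∀ {a b} → (a ≡ true → b ≡ true) → indicator a ≤ indicator b
indicator-mono {false} h = z≤n
indicator-mono {true}  h rewrite h refl = ≤-refl

countB-mono : {f g : Fin m → Bool} → (∀ i → f i ≡ true → g i ≡ true) → countB f ≤ countB g
countB-mono {zero}  h = z≤n
countB-mono {suc m} h = +-mono-≤ (indicator-mono (h F.zero)) (countB-mono (h ∘ F.suc))

countB-mono-< : {f g : Fin m → Bool} → (∀ i → f i ≡ true → g i ≡ true) →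
                ∀ a → f a ≡ false → g a ≡ true → countB f < countB g
countB-mono-< {suc m} h F.zero    fa ga rewrite fa | ga = s≤s (countB-mono (h ∘ F.suc))
countB-mono-< {suc m} h (F.suc a) fa ga =
  +-mono-≤-< (indicator-mono (h F.zero)) (countB-mono-< (h ∘ F.suc) a fa ga)

countB≤ : (f : Fin m → Bool) → countB f ≤ m
countB≤ {zero}  f = z≤n
countB≤ {suc m} f with f F.zero
... | true  = s≤s (countB≤ (f ∘ F.suc))
... | false = m≤n⇒m≤1+n (countB≤ (f ∘ F.suc))

countB-true : countB {m} (λ _ → true) ≡ m
countB-true {zero}  = refl
countB-true {suc m} = cong suc (countB-true {m})

countB-false : countB {m} (λ _ → false) ≡ 0
countB-false {zero}  = refl
countB-false {suc m} = countB-false {m}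

countB≡0⇒false : (f : Fin m → Bool) → countB f ≡ 0 → ∀ i → f i ≡ false
countB≡0⇒false {suc m} f e i with f F.zero in f0
countB≡0⇒false {suc m} f e F.zero    | false = f0
countB≡0⇒false {suc m} f e (F.suc i) | false = countB≡0⇒false (f ∘ F.suc) e i
countB≡0⇒false {suc m} f () i        | true

false⇒countB≡0 : (f : Fin m → Bool) → (∀ i → f i ≡ false) → countB f ≡ 0
false⇒countB≡0 {m} f h = trans (countB-cong h) (countB-false {m})

countB-witness : (f : Fin m → Bool) → 1 ≤ countB f → Σ (Fin m) (λ i → f i ≡ true)
countB-witness {suc m} f le with f F.zero in f0
... | true  = F.zero , f0
... | false = let i , fi = countB-witness (f ∘ F.suc) le in F.suc i , fi

countB-∨ : (f g : Fin m → Bool) → (∀ i → f i ∧ g i ≡ false) →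
           countB (λ i → f i ∨ g i) ≡ countB f + countB g
countB-∨ {zero}  f g h = refl
countB-∨ {suc m} f g h = begin
  indicator (f F.zero ∨ g F.zero) + countB (λ i → f (F.suc i) ∨ g (F.suc i))
    ≡⟨ cong₂ _+_ (indicator-∨ (f F.zero) (g F.zero) (h F.zero))
                 (countB-∨ (f ∘ F.suc) (g ∘ F.suc) (h ∘ F.suc)) ⟩
  (indicator (f F.zero) + indicator (g F.zero)) + (countB (f ∘ F.suc) + countB (g ∘ F.suc))
    ≡⟨ interchange +-commutativeSemigroup (indicator (f F.zero)) (indicator (g F.zero)) _ _ ⟩
  countB f + countB g ∎
  where
  open ≡-Reasoning
  indicator-∨ : ∀ a b → a ∧ b ≡ false → indicator (a ∨ b) ≡ indicator a + indicator b
  indicator-∨ true  false _ = refl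
  indicator-∨ false true  _ = refl
  indicator-∨ false false _ = refl

countB-split : (f g : Fin m → Bool) →
               countB f ≡ countB (λ i → f i ∧ g i) + countB (λ i → f i ∧ not (g i))
countB-split f g = trans (countB-cong (λ i → split (f i) (g i)))
                         (countB-∨ (λ i → f i ∧ g i) (λ i → f i ∧ not (g i)) λ i → disjoint (f i) (g i))
  where
  split : ∀ a b → a ≡ (a ∧ b) ∨ (a ∧ not b)
  split true  true  = refl
  split true  false = refl
  split false b     = refl
  disjoint : ∀ a b → (a ∧ b) ∧ (a ∧ not b) ≡ false
  disjoint true  true  = refl
  disjoint true  false = refl
  disjoint false b     = refl

countB-eqB : (a : Fin m) → countB (λ i → eqB i a) ≡ 1
countB-eqB {suc m} F.zero =
  cong suc (false⇒countB≡0 {m} (λ i → eqB (F.suc i) F.zero) (λ i → eqB-≢ {i = F.suc i} {F.zero} λ ()))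
countB-eqB {suc m} (F.suc a) rewrite eqB-≢ {i = F.zero} {F.suc a} (λ ()) =
  trans (countB-cong (λ i → eqB-suc i a)) (countB-eqB a)

countB-eqB′ : (a : Fin m) → countB (λ i → eqB a i) ≡ 1
countB-eqB′ a = trans (countB-cong (eqB-sym a)) (countB-eqB a)

countB-singleton : (f : Fin m → Bool) (a : Fin m) → f a ≡ true → (∀ b → f b ≡ true → b ≡ a) →
                   countB f ≡ 1
countB-singleton f a fa only-a = trans (countB-cong f≗eqB) (countB-eqB a)
  where
  f≗eqB : ∀ i → f i ≡ eqB i a
  f≗eqB i = ≡true-ext (λ fi → subst (λ l → eqB l a ≡ true) (sym (only-a i fi)) (eqB-refl a))
                      (λ i≡a → subst (λ l → f l ≡ true) (sym (eqB⇒≡ i≡a)) fa)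

2≤countB : (f : Fin m → Bool) (a b : Fin m) → f a ≡ true → f b ≡ true → ¬ a ≡ b → 2 ≤ countB f
2≤countB f a b fa fb a≢b = begin
  2                                      ≡⟨ cong₂ _+_ (countB-eqB a) (countB-eqB b) ⟨
  countB (λ i → eqB i a) + countB (λ i → eqB i b) ≡⟨ countB-∨ _ _ disjoint ⟨
  countB (λ i → eqB i a ∨ eqB i b)       ≤⟨ countB-mono ⊆f ⟩
  countB f                               ∎
  where
  open ≤-Reasoning
  disjoint : ∀ i → eqB i a ∧ eqB i b ≡ false
  disjoint i with i ≟ a | i ≟ b
  ... | yes refl | yes refl = ⊥-elim (a≢b refl)
  ... | yes _    | no _     = refl
  ... | no _     | _        = refl
  ⊆f : ∀ i → eqB i a ∨ eqB i b ≡ true → f i ≡ true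
  ⊆f i p with ∨-elim (eqB i a) p
  ... | inj₁ i≡a = subst (λ l → f l ≡ true) (sym (eqB⇒≡ i≡a)) fa
  ... | inj₂ i≡b = subst (λ l → f l ≡ true) (sym (eqB⇒≡ i≡b)) fb

another-true : (f : Fin m → Bool) (a : Fin m) → 2 ≤ countB f → Σ (Fin m) (λ b → ¬ b ≡ a × f b ≡ true)
another-true f a le with countB (λ b → f b ∧ not (eqB b a)) in e
... | suc _ =
  let b , p = countB-witness (λ b → f b ∧ not (eqB b a)) (subst (1 ≤_) (sym e) (s≤s z≤n))
  in  b
    , (λ b≡a → not-¬ (∧-conicalʳ (f b) _ p) (cong not (subst (λ l → eqB b l ≡ true) b≡a (eqB-refl b))))
    , ∧-conicalˡ (f b) _ p
... | zero = ⊥-elim (<⇒≱ le (≤-trans (countB-mono only-a) (≤-reflexive (countB-eqB a))))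
  where
  only-a : ∀ i → f i ≡ true → eqB i a ≡ true
  only-a i fi with i ≟ a
  ... | yes _  = refl
  ... | no i≢a = ⊥-elim (not-¬ (subst (λ z → z ∧ not (eqB i a) ≡ true) (sym fi) (cong not (eqB-≢ i≢a)))
                               (countB≡0⇒false _ e i))

least-true : (f : Fin m → Bool) (a : Fin m) → f a ≡ true →
             Σ (Fin m) (λ i → f i ≡ true × (∀ j → toℕ j < toℕ i → f j ≡ false))
least-true {suc m} f a fa with f F.zero in f0 | a
... | true  | _ = F.zero , f0 , (λ j ())
... | false | F.zero = ⊥-elim (not-¬ fa f0)
... | false | F.suc a =
  let i , fi , below = least-true (f ∘ F.suc) a fa
  in  F.suc i , fi , λ { F.zero _ → f0 ; (F.suc j) (s≤s j<i) → below j j<i }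

memB⇒∈ : {i : Fin m} (L : List (Fin m)) → memB i L ≡ true → i ∈ L
memB⇒∈ {i = i} (a ∷ L) p with i ≟ a
... | yes i≡a = here i≡a
... | no _    = there (memB⇒∈ L p)

∈⇒memB : {i : Fin m} {L : List (Fin m)} → i ∈ L → memB i L ≡ true
∈⇒memB {i = i} (here refl) rewrite eqB-refl i = refl
∈⇒memB {i = i} (there {x = a} p) = ∨-introʳ (eqB i a) (∈⇒memB p)

∉⇒memB : {i : Fin m} {L : List (Fin m)} → i ∉ L → memB i L ≡ false
∉⇒memB {L = L} i∉L = ¬-not (λ p → i∉L (memB⇒∈ L p))

memB-++ : (i : Fin m) (xs ys : List (Fin m)) → memB i (xs ++ ys) ≡ memB i xs ∨ memB i ys
memB-++ i []       ys = refl
memB-++ i (a ∷ xs) ys rewrite memB-++ i xs ys = sym (∨-assoc (eqB i a) _ _)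

memB-++⁺ˡ : (i : Fin m) (xs ys : List (Fin m)) → memB i xs ≡ true → memB i (xs ++ ys) ≡ true
memB-++⁺ˡ i xs ys p rewrite memB-++ i xs ys | p = refl

memB-++⁺ʳ : (i : Fin m) (xs ys : List (Fin m)) → memB i ys ≡ true → memB i (xs ++ ys) ≡ true
memB-++⁺ʳ i xs ys p rewrite memB-++ i xs ys = ∨-introʳ (memB i xs) p

memB-++⁻ : (i : Fin m) (xs ys : List (Fin m)) → memB i (xs ++ ys) ≡ true →
           memB i xs ≡ true ⊎ memB i ys ≡ true
memB-++⁻ i xs ys p rewrite memB-++ i xs ys = ∨-elim (memB i xs) p

memB-[_] : {i j : Fin m} → memB i (j ∷ []) ≡ true → i ≡ j
memB-[_] {i = i} {j} p = eqB⇒≡ (trans (sym (∨-identityʳ (eqB i j))) p)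

countB-memB : (L : List (Fin m)) → Unique L → countB (λ i → memB i L) ≡ length L
countB-memB {m} []      _          = countB-false {m}
countB-memB     (a ∷ L) (a∉L ∷ uL) =
  trans (countB-∨ (λ i → eqB i a) (λ i → memB i L) disjoint)
        (cong₂ _+_ (countB-eqB a) (countB-memB L uL))
  where
  disjoint : ∀ i → eqB i a ∧ memB i L ≡ false
  disjoint i with i ≟ a
  ... | no _     = refl
  ... | yes refl = ∉⇒memB (λ a∈L → All.lookup a∉L a∈L refl)

length≤ : (L : List (Fin m)) → Unique L → length L ≤ m
length≤ L uL = subst (_≤ _) (countB-memB L uL) (countB≤ _)

memB-nonempty : (L : List (Fin m)) → 1 ≤ length L → Σ (Fin m) (λ a → memB a L ≡ true)
memB-nonempty (a ∷ L) _ = a , ∨-introˡ (eqB-refl a)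

TwoMembers : List (Fin m) → Set
TwoMembers {m} L = Σ (Fin m) λ a → Σ (Fin m) λ b → ¬ a ≡ b × memB a L ≡ true × memB b L ≡ true

two-members : (L : List (Fin m)) → Unique L → 2 ≤ length L → TwoMembers L
two-members L uL 2≤ =
  let a , a∈ = memB-nonempty L (≤-trans (s≤s z≤n) 2≤)
      b , b≢a , b∈ = another-true (λ j → memB j L) a (subst (2 ≤_) (sym (countB-memB L uL)) 2≤)
  in  a , b , (λ a≡b → b≢a (sym a≡b)) , a∈ , b∈

memB-allFin : (i : Fin m) → memB i (allFin m) ≡ true
memB-allFin i = ∈⇒memB (∈-allFin i)

memB-filterᵇ : (i : Fin m) (p : Fin m → Bool) (xs : List (Fin m)) →
               memB i (filterᵇ p xs) ≡ memB i xs ∧ p i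
memB-filterᵇ i p []       = refl
memB-filterᵇ i p (a ∷ xs) with p a in pa
... | true with i ≟ a
...   | yes refl = sym pa
...   | no _     = memB-filterᵇ i p xs
memB-filterᵇ i p (a ∷ xs) | false with i ≟ a
...   | yes refl = trans (memB-filterᵇ i p xs) (trans (cong (memB i xs ∧_) pa) (trans (∧-zeroʳ _) (sym pa)))
...   | no _     = memB-filterᵇ i p xs

members : (Fin m → Bool) → List (Fin m)
members {m} p = filterᵇ p (allFin m)

memB-members : (p : Fin m → Bool) (i : Fin m) → memB i (members p) ≡ p i
memB-members {m} p i rewrite memB-filterᵇ i p (allFin m) | memB-allFin i = refl

members-unique : (p : Fin m → Bool) → Unique (members p)
members-unique {m} p = Unique.filter⁺ _ (Unique.allFin⁺ m)

length-members : (p : Fin m → Bool) → length (members p) ≡ countB p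
length-members p = trans (sym (countB-memB (members p) (members-unique p))) (countB-cong (memB-members p))

unique-↭ : {xs ys : List (Fin m)} → xs ↭ ys → Unique ys → Unique xs
unique-↭ {m} xs↭ys = PermutationSetoid.Unique-resp-↭ (setoid (Fin m)) (↭⇒↭ₛ (↭-sym xs↭ys))

unique-++ˡ : (xs : List (Fin m)) {ys : List (Fin m)} → Unique (xs ++ ys) → Unique xs
unique-++ˡ []       _          = []
unique-++ˡ (x ∷ xs) (x∉ ∷ u) = All.++⁻ˡ xs x∉ ∷ unique-++ˡ xs u

unique-++ʳ : (xs : List (Fin m)) {ys : List (Fin m)} → Unique (xs ++ ys) → Unique ys
unique-++ʳ []       u       = u
unique-++ʳ (x ∷ xs) (_ ∷ u) = unique-++ʳ xs u

unique-++-disjoint : (xs : List (Fin m)) {ys : List (Fin m)} → Unique (xs ++ ys) →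
                     ∀ i → memB i xs ≡ true → memB i ys ≡ false
unique-++-disjoint (x ∷ xs) (x∉ ∷ u) i p with i ≟ x
... | yes refl = ∉⇒memB (λ i∈ys → All.lookup (All.++⁻ʳ xs x∉) i∈ys refl)
... | no _     = unique-++-disjoint xs u i p

+-cong-≡[mod] : ∀ {a b c d} k .{{_ : NonZero k}} →
                a ≡[mod k ] c → b ≡[mod k ] d → (a + b) ≡[mod k ] (c + d)
+-cong-≡[mod] {a} {b} {c} {d} k a≡c b≡d = begin
  (a + b) % k           ≡⟨ %-distribˡ-+ a b k ⟩
  (a % k + b % k) % k   ≡⟨ cong₂ (λ x y → (x + y) % k) a≡c b≡d ⟩
  (c % k + d % k) % k   ≡⟨ %-distribˡ-+ c d k ⟨
  (c + d) % k           ∎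
  where open ≡-Reasoning

suc-cancel-≡[mod] : ∀ {a b} k .{{_ : NonZero k}} → suc a ≡[mod k ] suc b → a ≡[mod k ] b
suc-cancel-≡[mod] {a} {b} k@(suc k-1) 1+a≡1+b = begin
  a % k                 ≡⟨ [m+n]%n≡m%n a k ⟨
  (a + k) % k           ≡⟨ cong (_% k) (+-suc a k-1) ⟩
  (suc a + k-1) % k     ≡⟨ +-cong-≡[mod] {suc a} {k-1} {suc b} {k-1} k 1+a≡1+b refl ⟩
  (suc b + k-1) % k     ≡⟨ cong (_% k) (+-suc b k-1) ⟨
  (b + k) % k           ≡⟨ [m+n]%n≡m%n b k ⟩
  b % k                 ∎
  where open ≡-Reasoning

ιRel-refl : (L : List (Fin m)) (i : Fin m) → ιRel L i i ≡ true
ιRel-refl L i rewrite eqB-refl i = refl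

ιRel-block : (L : List (Fin m)) {i j : Fin m} → memB i L ≡ true → memB j L ≡ true → ιRel L i j ≡ true
ιRel-block L {i} {j} i∈L j∈L = ∨-introʳ (eqB i j) (∧-intro i∈L j∈L)

ιRel-elim : (L : List (Fin m)) {i j : Fin m} → ιRel L i j ≡ true →
            i ≡ j ⊎ (memB i L ≡ true × memB j L ≡ true)
ιRel-elim L {i} {j} p with ∨-elim (eqB i j) p
... | inj₁ i≡j = inj₁ (eqB⇒≡ i≡j)
... | inj₂ q   = inj₂ (∧-conicalˡ (memB i L) _ q , ∧-conicalʳ (memB i L) _ q)

ιRel-sym : (L : List (Fin m)) (i j : Fin m) → ιRel L i j ≡ true → ιRel L j i ≡ true
ιRel-sym L i j p with ιRel-elim L p
... | inj₁ refl          = p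
... | inj₂ (i∈L , j∈L)   = ιRel-block L j∈L i∈L

ιRel-trans : (L : List (Fin m)) (i j l : Fin m) →
             ιRel L i j ≡ true → ιRel L j l ≡ true → ιRel L i l ≡ true
ιRel-trans L i j l p q with ιRel-elim L p | ιRel-elim L q
... | inj₁ refl        | _                = q
... | inj₂ _           | inj₁ refl        = p
... | inj₂ (i∈L , _)   | inj₂ (_ , l∈L)   = ιRel-block L i∈L l∈L

ιPart : List (Fin m) → Partition m
ιPart L = mkPartition (ιRel L) record
  { reflP = ιRel-refl L ; symP = ιRel-sym L ; transP = ιRel-trans L }

module _ (x : Partition m) where
  open IsPartition (isPart x)

  isRep⇒minimal : ∀ r → isRep x r ≡ true → ∀ j → toℕ j < toℕ r → rel x r j ≡ false
  isRep⇒minimal r p j j<r = ¬-not λ rj →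
    not-¬ (∧-intro (Equivalence.to T-≡ (<⇒<ᵇ j<r)) rj)
          (countB≡0⇒false _ (≡ᵇ⇒≡ _ 0 (Equivalence.from T-≡ p)) j)

  minimal⇒isRep : ∀ r → (∀ j → toℕ j < toℕ r → rel x r j ≡ false) → isRep x r ≡ true
  minimal⇒isRep r h = Equivalence.to T-≡ (≡⇒≡ᵇ _ 0 (false⇒countB≡0 _ below))
    where
    below : ∀ j → (toℕ j <ᵇ toℕ r) ∧ rel x r j ≡ false
    below j with toℕ j <ᵇ toℕ r in j<r
    ... | false = refl
    ... | true  = h j (<ᵇ⇒< _ _ (Equivalence.from T-≡ j<r))

  representative : ∀ i → Σ (Fin m) (λ r → rel x i r ≡ true × isRep x r ≡ true)
  representative i =
    let r , ir , least = least-true (rel x i) i (reflP i)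
    in  r , ir , minimal⇒isRep r (λ j j<r → ¬-not (λ rj → not-¬ (transP i r j ir rj) (least j j<r)))

  representative-unique : ∀ r s → isRep x r ≡ true → isRep x s ≡ true → rel x r s ≡ true → r ≡ s
  representative-unique r s rep-r rep-s rs with <-cmp (toℕ r) (toℕ s)
  ... | tri≈ _ r≡s _ = toℕ-injective r≡s
  ... | tri< r<s _ _ = ⊥-elim (not-¬ (symP r s rs) (isRep⇒minimal s rep-s r r<s))
  ... | tri> _ _ s<r = ⊥-elim (not-¬ rs (isRep⇒minimal r rep-r s s<r))

  blockSize-resp : ∀ i j → rel x i j ≡ true → blockSize x i ≡ blockSize x j
  blockSize-resp i j ij = countB-cong λ l → ≡true-ext (transP j i l (symP i j ij)) (transP i j l ij)

  Nontrivial : Fin m → Set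
  Nontrivial i = Σ (Fin m) (λ j → ¬ i ≡ j × rel x i j ≡ true)

  nontrivial⇒2≤blockSize : ∀ i → Nontrivial i → 2 ≤ blockSize x i
  nontrivial⇒2≤blockSize i (j , i≢j , ij) = 2≤countB (rel x i) i j (reflP i) ij i≢j

  2≤blockSize⇒nontrivial : ∀ i → 2 ≤ blockSize x i → Nontrivial i
  2≤blockSize⇒nontrivial i 2≤ =
    let j , j≢i , ij = another-true (rel x i) i 2≤ in j , (λ i≡j → j≢i (sym i≡j)) , ij

  -- Representatives of two different nontrivial blocks would both be counted by InI.
  InI⇒nontrivial-related : InI x → ∀ i i′ → Nontrivial i → Nontrivial i′ → rel x i i′ ≡ true
  InI⇒nontrivial-related ini i i′ nt nt′
    with representative i | representative i′
  ... | r , ir , rep-r | r′ , ir′ , rep-r′ with r ≟ r′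
  ... | yes refl = transP i r i′ ir (symP i′ r ir′)
  ... | no r≢r′  =
    let 2≤ = 2≤countB _ r r′ (counted r i ir rep-r nt) (counted r′ i′ ir′ rep-r′ nt′) r≢r′
    in  ⊥-elim (<⇒≢ 2≤ (sym ini))
    where
    counted : ∀ s t → rel x t s ≡ true → isRep x s ≡ true → Nontrivial t →
              isRep x s ∧ (1 <ᵇ blockSize x s) ≡ true
    counted s t ts rep-s nt-t = ∧-intro rep-s (Equivalence.to T-≡ (<⇒<ᵇ
      (subst (2 ≤_) (blockSize-resp t s ts) (nontrivial⇒2≤blockSize t nt-t))))

  InI⇒nontrivial : InI x → Σ (Fin m) Nontrivial
  InI⇒nontrivial ini =
    let r , p = countB-witness _ (≤-reflexive (sym ini))
    in  r , 2≤blockSize⇒nontrivial r (<ᵇ⇒< 1 _ (Equivalence.from T-≡ (∧-conicalʳ (isRep x r) _ p)))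

module _ (x y : Partition m) (x≈y : x ≈ y) where

  isRep-cong : ∀ i → isRep x i ≡ isRep y i
  isRep-cong i = cong (_≡ᵇ 0) (countB-cong (λ j → cong ((toℕ j <ᵇ toℕ i) ∧_) (x≈y i j)))

  InG-cong : ∀ k .{{_ : NonZero k}} → InG k x → InG k y
  InG-cong k (ini , rk≡0) =
      trans (sym (countB-cong λ i → cong₂ (λ a b → a ∧ (1 <ᵇ b)) (isRep-cong i) (countB-cong (x≈y i))))
            ini
    , trans (cong (λ n → (m ∸ n) % k) (sym (countB-cong isRep-cong))) rk≡0

record ValidBlock (k : ℕ) .{{_ : NonZero k}} (L : List (Fin m)) : Set where
  constructor validBlock
  field
    unique   : Unique L
    2≤length : 2 ≤ length L
    length≡1 : length L ≡[mod k ] 1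
open ValidBlock public

module OneBlock (x : Partition m) (L : List (Fin m)) (x≈ιL : rel x ≈ᴿ ιRel L) (uL : Unique L) where

  row-in : ∀ i → memB i L ≡ true → ∀ j → rel x i j ≡ memB j L
  row-in i i∈L j rewrite x≈ιL i j | i∈L with i ≟ j
  ... | yes refl = sym i∈L
  ... | no _     = refl

  row-out : ∀ i → memB i L ≡ false → ∀ j → rel x i j ≡ eqB i j
  row-out i i∉L j rewrite x≈ιL i j | i∉L = ∨-identityʳ _

  blockSize-in : ∀ i → memB i L ≡ true → blockSize x i ≡ length L
  blockSize-in i i∈L = trans (countB-cong (row-in i i∈L)) (countB-memB L uL)

  blockSize-out : ∀ i → memB i L ≡ false → blockSize x i ≡ 1
  blockSize-out i i∉L = trans (countB-cong (row-out i i∉L)) (countB-eqB′ i)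

  isRep-out : ∀ i → memB i L ≡ false → isRep x i ≡ true
  isRep-out i i∉L = minimal⇒isRep x i λ j j<i →
    trans (row-out i i∉L j) (eqB-≢ (λ i≡j → <⇒≢ j<i (sym (cong toℕ i≡j))))

  module _ (a : Fin m) (a∈L : memB a L ≡ true) where

    private
      least = least-true (λ i → memB i L) a a∈L
      r = proj₁ least
      r∈L = proj₁ (proj₂ least)

    isRep-min : isRep x r ≡ true
    isRep-min = minimal⇒isRep x r λ j j<r → trans (row-in r r∈L j) (proj₂ (proj₂ least) j j<r)

    isRep-in : ∀ b → isRep x b ≡ true → memB b L ≡ true → b ≡ r
    isRep-in b rep-b b∈L = representative-unique x b r rep-b isRep-min (trans (row-in b b∈L r) r∈L)

    numBlocks≡ : numBlocks x ≡ 1 + (m ∸ length L)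
    numBlocks≡ = begin
      countB (isRep x)
        ≡⟨ countB-split (isRep x) (λ i → memB i L) ⟩
      countB (λ i → isRep x i ∧ memB i L) + countB (λ i → isRep x i ∧ not (memB i L))
        ≡⟨ cong₂ _+_ (countB-singleton _ r (∧-intro isRep-min r∈L) only-r) (countB-cong outside) ⟩
      1 + countB (λ i → not (memB i L))
        ≡⟨ cong (1 +_) (m+n∸m≡n (length L) _) ⟨
      1 + (length L + countB (λ i → not (memB i L)) ∸ length L)
        ≡⟨ cong (λ n → 1 + (n ∸ length L)) total ⟨
      1 + (m ∸ length L) ∎
      where
      open ≡-Reasoning
      only-r : ∀ b → isRep x b ∧ memB b L ≡ true → b ≡ r
      only-r b p = isRep-in b (∧-conicalˡ (isRep x b) _ p) (∧-conicalʳ (isRep x b) _ p)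
      outside : ∀ i → isRep x i ∧ not (memB i L) ≡ not (memB i L)
      outside i with memB i L in i∈L
      ... | true  = ∧-zeroʳ _
      ... | false = cong (_∧ true) (isRep-out i i∈L)
      total : m ≡ length L + countB (λ i → not (memB i L))
      total = begin
        m                                  ≡⟨ countB-true {m} ⟨
        countB {m} (λ _ → true)            ≡⟨ countB-split (λ _ → true) (λ i → memB i L) ⟩
        countB (λ i → memB i L) + countB (λ i → not (memB i L))
                                           ≡⟨ cong (_+ countB (λ i → not (memB i L))) (countB-memB L uL) ⟩
        length L + countB (λ i → not (memB i L)) ∎

    rk≡ : rk x ≡ length L ∸ 1
    rk≡ = begin
      m ∸ numBlocks x           ≡⟨ cong (m ∸_) numBlocks≡ ⟩
      m ∸ (1 + (m ∸ length L))  ≡⟨ cong (m ∸_) (+-comm 1 _) ⟩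
      m ∸ ((m ∸ length L) + 1)  ≡⟨ ∸-+-assoc m (m ∸ length L) 1 ⟨
      m ∸ (m ∸ length L) ∸ 1    ≡⟨ cong (_∸ 1) (m∸[m∸n]≡n (length≤ L uL)) ⟩
      length L ∸ 1              ∎
      where open ≡-Reasoning

    InI-oneBlock : 2 ≤ length L → InI x
    InI-oneBlock 2≤ = countB-singleton _ r (∧-intro isRep-min (Equivalence.to T-≡ (<⇒<ᵇ r-large))) only-r
      where
      r-large : 1 < blockSize x r
      r-large = subst (2 ≤_) (sym (blockSize-in r r∈L)) 2≤
      only-r : ∀ b → isRep x b ∧ (1 <ᵇ blockSize x b) ≡ true → b ≡ r
      only-r b p with memB b L in b∈L
      ... | true  = isRep-in b (∧-conicalˡ (isRep x b) _ p) b∈L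
      ... | false = ⊥-elim (not-¬ (∧-conicalʳ (isRep x b) _ p)
                                  (cong (1 <ᵇ_) (blockSize-out b b∈L)))

  InG-oneBlock : ∀ k .{{_ : NonZero k}} → 2 ≤ length L → length L ≡[mod k ] 1 → InG k x
  InG-oneBlock k 2≤ len≡1 =
    let a , a∈L = memB-nonempty L (≤-trans (s≤s z≤n) 2≤)
        1≤len = ≤-trans (s≤s z≤n) 2≤
    in    InI-oneBlock a a∈L 2≤
        , subst (_≡[mod k ] 0) (sym (rk≡ a a∈L))
            (suc-cancel-≡[mod] k (subst (_≡[mod k ] 1) (sym (trans (+-comm 1 _) (m∸n+n≡m 1≤len))) len≡1))

-- Records rather than plain function types, so that A and B can be inferred from a proof.
record _⊆ᴮ_ (A B : List (Fin m)) : Set where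
  constructor ⊆ᴮ-intro
  field ⊆ᴮ-elim : ∀ i → memB i A ≡ true → memB i B ≡ true
open _⊆ᴮ_ public

record Disjointᴮ (A B : List (Fin m)) : Set where
  constructor disjointᴮ-intro
  field disjointᴮ-elim : ∀ i → memB i A ≡ true → memB i B ≡ false
open Disjointᴮ public

NestedOrDisjoint : List (Fin m) → List (Fin m) → Set
NestedOrDisjoint A B = A ⊆ᴮ B ⊎ B ⊆ᴮ A ⊎ Disjointᴮ A B

⊆ᴮ-refl : {A : List (Fin m)} → A ⊆ᴮ A
⊆ᴮ-refl = ⊆ᴮ-intro λ _ a → a

⊆ᴮ-trans : {A B C : List (Fin m)} → A ⊆ᴮ B → B ⊆ᴮ C → A ⊆ᴮ C
⊆ᴮ-trans A⊆B B⊆C = ⊆ᴮ-intro λ i a → ⊆ᴮ-elim B⊆C i (⊆ᴮ-elim A⊆B i a)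

⊆ᴮ-++ˡ : (xs ys : List (Fin m)) → xs ⊆ᴮ (xs ++ ys)
⊆ᴮ-++ˡ xs ys = ⊆ᴮ-intro λ i → memB-++⁺ˡ i xs ys

⊆ᴮ-++ʳ : (xs ys : List (Fin m)) → ys ⊆ᴮ (xs ++ ys)
⊆ᴮ-++ʳ xs ys = ⊆ᴮ-intro λ i → memB-++⁺ʳ i xs ys

⊆ᴮ? : (A B : List (Fin m)) → A ⊆ᴮ B ⊎ Σ (Fin m) (λ i → memB i A ≡ true × memB i B ≡ false)
⊆ᴮ? A B with countB (λ i → memB i A ∧ not (memB i B)) in count≡
... | zero  = inj₁ (⊆ᴮ-intro λ i i∈A →
    not-injective (subst (λ b → b ∧ not (memB i B) ≡ false) i∈A (countB≡0⇒false _ count≡ i)))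
... | suc _ =
  let i , p = countB-witness (λ i → memB i A ∧ not (memB i B)) (subst (1 ≤_) (sym count≡) (s≤s z≤n))
  in  inj₂ (i , ∧-conicalˡ (memB i A) _ p , not-injective (∧-conicalʳ (memB i A) _ p))

record _≐_ (A B : List (Fin m)) : Set where
  constructor ≐-intro
  field ≐-elim : ∀ i → memB i A ≡ memB i B
open _≐_ public

≐-sym : {A B : List (Fin m)} → A ≐ B → B ≐ A
≐-sym A≐B = ≐-intro λ i → sym (≐-elim A≐B i)

⊆ᴮ-antisym : {A B : List (Fin m)} → A ⊆ᴮ B → B ⊆ᴮ A → A ≐ B
⊆ᴮ-antisym A⊆B B⊆A = ≐-intro λ i → ≡true-ext (⊆ᴮ-elim A⊆B i) (⊆ᴮ-elim B⊆A i)

ιRel-≐ : {A B : List (Fin m)} → A ≐ B → ιRel A ≈ᴿ ιRel B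
ιRel-≐ A≐B i j rewrite ≐-elim A≐B i | ≐-elim A≐B j = refl

≐⇒length≡ : {A B : List (Fin m)} → Unique A → Unique B → A ≐ B → length A ≡ length B
≐⇒length≡ {A = A} {B} uA uB A≐B =
  trans (sym (countB-memB A uA)) (trans (countB-cong (≐-elim A≐B)) (countB-memB B uB))

⊆ᴮ∧length≤⇒⊇ᴮ : {A B : List (Fin m)} → Unique A → Unique B → A ⊆ᴮ B → length B ≤ length A → B ⊆ᴮ A
⊆ᴮ∧length≤⇒⊇ᴮ {A = A} {B} uA uB A⊆B |B|≤|A| with ⊆ᴮ? B A
... | inj₁ B⊆A             = B⊆A
... | inj₂ (i , i∈B , i∉A) = ⊥-elim (<⇒≱ |A|<|B| |B|≤|A|)
  where
  |A|<|B| : length A < length B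
  |A|<|B| = subst₂ _<_ (countB-memB A uA) (countB-memB B uB) (countB-mono-< (⊆ᴮ-elim A⊆B) i i∉A i∈B)

⊆ᴮ-dec : (A B : List (Fin m)) → Dec (A ⊆ᴮ B)
⊆ᴮ-dec A B with ⊆ᴮ? A B
... | inj₁ A⊆B           = yes A⊆B
... | inj₂ (i , i∈A , i∉B) = no λ A⊆B → not-¬ (⊆ᴮ-elim A⊆B i i∈A) i∉B

¬⊆ᴮ⇒witness : (A B : List (Fin m)) → ¬ A ⊆ᴮ B →
               Σ (Fin m) (λ i → memB i A ≡ true × memB i B ≡ false)
¬⊆ᴮ⇒witness A B A⊈B with ⊆ᴮ? A B
... | inj₁ A⊆B = ⊥-elim (A⊈B A⊆B)
... | inj₂ w   = w

mutual
  internalSets⊆leaves : (t : Tree m) {A : List (Fin m)} → A ∈ internalSets t → A ⊆ᴮ leaves t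
  internalSets⊆leaves (node ts) (here refl) = ⊆ᴮ-refl
  internalSets⊆leaves (node ts) (there p)   = internalSetsL⊆leavesL ts p

  internalSetsL⊆leavesL : (ts : List (Tree m)) {A : List (Fin m)} → A ∈ internalSetsL ts → A ⊆ᴮ leavesL ts
  internalSetsL⊆leavesL (t ∷ ts) p with ∈-++⁻ (internalSets t) p
  ... | inj₁ q = ⊆ᴮ-trans (internalSets⊆leaves t q) (⊆ᴮ-++ˡ (leaves t) (leavesL ts))
  ... | inj₂ q = ⊆ᴮ-trans (internalSetsL⊆leavesL ts q) (⊆ᴮ-++ʳ (leaves t) (leavesL ts))

-- Leaf sets of different subtrees are disjoint because no leaf label repeats.
mutual
  internalSets-laminar : (t : Tree m) → Unique (leaves t) → {A B : List (Fin m)} →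
                         A ∈ internalSets t → B ∈ internalSets t → NestedOrDisjoint A B
  internalSets-laminar (node ts) u (here refl) (here refl) = inj₁ ⊆ᴮ-refl
  internalSets-laminar (node ts) u (here refl) (there q)   = inj₂ (inj₁ (internalSetsL⊆leavesL ts q))
  internalSets-laminar (node ts) u (there p)   (here refl) = inj₁ (internalSetsL⊆leavesL ts p)
  internalSets-laminar (node ts) u (there p)   (there q)   = internalSetsL-laminar ts u p q

  internalSetsL-laminar : (ts : List (Tree m)) → Unique (leavesL ts) → {A B : List (Fin m)} →
                          A ∈ internalSetsL ts → B ∈ internalSetsL ts → NestedOrDisjoint A B
  internalSetsL-laminar (t ∷ ts) u p q with ∈-++⁻ (internalSets t) p | ∈-++⁻ (internalSets t) q
  ... | inj₁ p′ | inj₁ q′ = internalSets-laminar t (unique-++ˡ (leaves t) u) p′ q′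
  ... | inj₂ p′ | inj₂ q′ = internalSetsL-laminar ts (unique-++ʳ (leaves t) u) p′ q′
  ... | inj₁ p′ | inj₂ q′ = inj₂ (inj₂ (disjointᴮ-intro λ i a → ¬-not λ b →
        not-¬ (⊆ᴮ-elim (internalSetsL⊆leavesL ts q′) i b)
              (unique-++-disjoint (leaves t) u i (⊆ᴮ-elim (internalSets⊆leaves t p′) i a))))
  ... | inj₂ p′ | inj₁ q′ = inj₂ (inj₂ (disjointᴮ-intro λ i a → ¬-not λ b →
        not-¬ (⊆ᴮ-elim (internalSetsL⊆leavesL ts p′) i a)
              (unique-++-disjoint (leaves t) u i (⊆ᴮ-elim (internalSets⊆leaves t q′) i b))))

module _ (k : ℕ) .{{_ : NonZero k}} where

  mutual
    leaves-length : (t : Tree m) → ValidDeg k t → 1 ≤ length (leaves t) × length (leaves t) ≡[mod k ] 1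
    leaves-length (leaf i)  _ = ≤-refl , refl
    leaves-length (node ts) (1<deg , deg≡1 , v) =
      let deg≤ , len≡deg = leavesL-length ts v in ≤-trans (<⇒≤ 1<deg) deg≤ , trans len≡deg deg≡1

    leavesL-length : (ts : List (Tree m)) → ValidDegL k ts →
                     length ts ≤ length (leavesL ts) × length (leavesL ts) ≡[mod k ] length ts
    leavesL-length []       _        = z≤n , refl
    leavesL-length (t ∷ ts) (vt , v) rewrite length-++ (leaves t) {leavesL ts} =
      let 1≤ , t≡1 = leaves-length t vt
          ts≤ , ts≡ = leavesL-length ts v
      in  +-mono-≤ 1≤ ts≤ , +-cong-≡[mod] {length (leaves t)} {_} {1} k t≡1 ts≡

  mutual
    internalSets-valid : (t : Tree m) → ValidDeg k t → Unique (leaves t) → All (ValidBlock k) (internalSets t)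
    internalSets-valid (leaf i)  _                   _ = []
    internalSets-valid (node ts) (1<deg , deg≡1 , v) u =
      let deg≤ , len≡deg = leavesL-length ts v
      in  validBlock u (≤-trans 1<deg deg≤) (trans len≡deg deg≡1) ∷ internalSetsL-valid ts v u

    internalSetsL-valid : (ts : List (Tree m)) → ValidDegL k ts → Unique (leavesL ts) →
                          All (ValidBlock k) (internalSetsL ts)
    internalSetsL-valid []       _        _ = []
    internalSetsL-valid (t ∷ ts) (vt , v) u =
      All.++⁺ (internalSets-valid t vt (unique-++ˡ (leaves t) u))
              (internalSetsL-valid ts v (unique-++ʳ (leaves t) u))

  -- A leaf set below a child of the root misses the leaves of some other child.
  internalSetsL-proper : (ts : List (Tree m)) → 1 < length ts → ValidDegL k ts → Unique (leavesL ts) →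
                         {A : List (Fin m)} → A ∈ internalSetsL ts → Σ (Fin m) (λ c → memB c A ≡ false)
  internalSetsL-proper (t ∷ []) (s≤s ()) _ _ _
  internalSetsL-proper (t₁ ∷ t₂ ∷ ts) _ (v₁ , v₂ , _) u p with ∈-++⁻ (internalSets t₁) p
  ... | inj₁ q =
    let c , c∈t₂ = memB-nonempty (leaves t₂) (proj₁ (leaves-length t₂ v₂))
    in  c , ¬-not λ c∈A → not-¬ (⊆ᴮ-elim (⊆ᴮ-++ˡ (leaves t₂) (leavesL ts)) c c∈t₂)
                                (unique-++-disjoint (leaves t₁) u c (⊆ᴮ-elim (internalSets⊆leaves t₁ q) c c∈A))
  ... | inj₂ q =
    let c , c∈t₁ = memB-nonempty (leaves t₁) (proj₁ (leaves-length t₁ v₁))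
    in  c , ¬-not λ c∈A → not-¬ (⊆ᴮ-elim (internalSetsL⊆leavesL (t₂ ∷ ts) q) c c∈A)
                                (unique-++-disjoint (leaves t₁) u c c∈t₁)

module ClassOf (j : Partition m) (i : Fin m) where
  open IsPartition (isPart j)

  class : List (Fin m)
  class = members (rel j i)

  classPart : Partition m
  classPart = ιPart class

  classPart⊑ : classPart ⊑ j
  classPart⊑ a b ab with ιRel-elim class ab
  ... | inj₁ refl        = reflP a
  ... | inj₂ (a∈ , b∈)   = transP a i b (symP i a (trans (sym (memB-members (rel j i) a)) a∈))
                                        (trans (sym (memB-members (rel j i) b)) b∈)

  ⊑classPart : ∀ {z D} → rel z ≈ᴿ ιRel D → memB i D ≡ true → z ⊑ j → z ⊑ classPart
  ⊑classPart {z} {D} z≈ιD i∈D z⊑j a b zab with ιRel-elim D (trans (sym (z≈ιD a b)) zab)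
  ... | inj₁ refl        = ιRel-refl class a
  ... | inj₂ (a∈D , b∈D) = ιRel-block class (in-class a a∈D) (in-class b b∈D)
    where
    in-class : ∀ l → memB l D ≡ true → memB l class ≡ true
    in-class l l∈D = trans (memB-members (rel j i) l) (z⊑j i l (trans (z≈ιD i l) (ιRel-block D i∈D l∈D)))

  module _ (k : ℕ) .{{_ : NonZero k}} (j∈Πk : InPiK k j) where
    private
      module C = OneBlock classPart class (λ _ _ → refl) (members-unique (rel j i))
      |class|≡1 : length class ≡[mod k ] 1
      |class|≡1 = trans (cong (_% k) (length-members (rel j i))) (j∈Πk i)

    classPart∈Πk : InPiK k classPart
    classPart∈Πk l = by-membership (memB l class) refl
      where
      by-membership : ∀ b → memB l class ≡ b → blockSize classPart l ≡[mod k ] 1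
      by-membership true  l∈ = trans (cong (_% k) (C.blockSize-in l l∈)) |class|≡1
      by-membership false l∉ = cong (_% k) (C.blockSize-out l l∉)

    classPart∈G : 2 ≤ blockSize j i → InG k classPart
    classPart∈G 2≤ = C.InG-oneBlock k (subst (2 ≤_) (sym (length-members (rel j i))) 2≤) |class|≡1

PartitionBlock : ℕ → Set
PartitionBlock m = Partition m × List (Fin m)

HasBlock : PartitionBlock m → Set
HasBlock (x , L) = rel x ≈ᴿ ιRel L

module DisjointJoin (k : ℕ) .{{_ : NonZero k}} (ps : List (PartitionBlock m))
  (valid : All (λ p → ValidBlock k (proj₂ p) × HasBlock p) ps)
  (disjoint : AllPairs (λ p q → Disjointᴮ (proj₂ p) (proj₂ q)) ps) where

  inSomeBlock : List (PartitionBlock m) → Fin m → Fin m → Bool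
  inSomeBlock []             i j = false
  inSomeBlock ((_ , L) ∷ qs) i j = (memB i L ∧ memB j L) ∨ inSomeBlock qs i j

  joinRel : BRel m
  joinRel i j = eqB i j ∨ inSomeBlock ps i j

  inSomeBlock-out : ∀ qs i → (∀ {p} → p ∈ qs → memB i (proj₂ p) ≡ false) →
                    ∀ j → inSomeBlock qs i j ≡ false
  inSomeBlock-out []       i i∉ j = refl
  inSomeBlock-out (p ∷ qs) i i∉ j rewrite i∉ (here refl) = inSomeBlock-out qs i (i∉ ∘ there) j

  inSomeBlock-in : ∀ qs → AllPairs (λ p q → Disjointᴮ (proj₂ p) (proj₂ q)) qs →
                   ∀ {p} → p ∈ qs → ∀ i → memB i (proj₂ p) ≡ true →
                   ∀ j → inSomeBlock qs i j ≡ memB j (proj₂ p)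
  inSomeBlock-in (p ∷ qs) (d ∷ _) (here refl) i i∈ j rewrite i∈ =
    trans (cong (memB j (proj₂ p) ∨_)
                (inSomeBlock-out qs i (λ q∈ → disjointᴮ-elim (All.lookup d q∈) i i∈) j))
          (∨-identityʳ _)
  inSomeBlock-in (p₀ ∷ qs) (d ∷ ds) (there p∈) i i∈ j
    rewrite ¬-not {memB i (proj₂ p₀)} (λ i∈₀ → not-¬ i∈ (disjointᴮ-elim (All.lookup d p∈) i i∈₀)) =
    inSomeBlock-in qs ds p∈ i i∈ j

  locate : ∀ i → Σ (PartitionBlock m) (λ p → p ∈ ps × memB i (proj₂ p) ≡ true)
               ⊎ (∀ {p} → p ∈ ps → memB i (proj₂ p) ≡ false)
  locate i = go ps
    where
    go : ∀ qs → Σ (PartitionBlock m) (λ p → p ∈ qs × memB i (proj₂ p) ≡ true)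
                ⊎ (∀ {p} → p ∈ qs → memB i (proj₂ p) ≡ false)
    go []       = inj₂ λ ()
    go (p ∷ qs) with memB i (proj₂ p) in i∈ | go qs
    ... | true  | _                    = inj₁ (p , here refl , i∈)
    ... | false | inj₁ (q , q∈ , i∈q) = inj₁ (q , there q∈ , i∈q)
    ... | false | inj₂ i∉             = inj₂ λ { (here refl) → i∈ ; (there q∈) → i∉ q∈ }

  row-in : ∀ {p} → p ∈ ps → ∀ i → memB i (proj₂ p) ≡ true →
           ∀ j → joinRel i j ≡ memB j (proj₂ p)
  row-in p∈ i i∈ j rewrite inSomeBlock-in ps disjoint p∈ i i∈ j with i ≟ j
  ... | yes refl = sym i∈
  ... | no _     = refl

  row-out : ∀ i → (∀ {p} → p ∈ ps → memB i (proj₂ p) ≡ false) → ∀ j → joinRel i j ≡ eqB i j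
  row-out i i∉ j rewrite inSomeBlock-out ps i i∉ j = ∨-identityʳ _

  joinRel-refl : ∀ i → joinRel i i ≡ true
  joinRel-refl i rewrite eqB-refl i = refl

  joinRel-sym : ∀ i j → joinRel i j ≡ true → joinRel j i ≡ true
  joinRel-sym i j ij with locate i
  ... | inj₁ (p , p∈ , i∈) = trans (row-in p∈ j (trans (sym (row-in p∈ i i∈ j)) ij) i) i∈
  ... | inj₂ i∉ =
    subst (λ l → joinRel j l ≡ true) (sym (eqB⇒≡ (trans (sym (row-out i i∉ j)) ij))) (joinRel-refl j)

  joinRel-trans : ∀ i j l → joinRel i j ≡ true → joinRel j l ≡ true → joinRel i l ≡ true
  joinRel-trans i j l ij jl with locate i
  ... | inj₁ (p , p∈ , i∈) =
    let j∈ = trans (sym (row-in p∈ i i∈ j)) ij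
    in  trans (row-in p∈ i i∈ l) (trans (sym (row-in p∈ j j∈ l)) jl)
  ... | inj₂ i∉ = subst (λ z → joinRel z l ≡ true) (sym (eqB⇒≡ (trans (sym (row-out i i∉ j)) ij))) jl

  join : Partition m
  join = mkPartition joinRel record { reflP = joinRel-refl ; symP = joinRel-sym ; transP = joinRel-trans }

  private
    validOf : ∀ {p} → p ∈ ps → ValidBlock k (proj₂ p) × HasBlock p
    validOf = All.lookup valid

  blockSize-in : ∀ {p} → p ∈ ps → ∀ i → memB i (proj₂ p) ≡ true →
                 blockSize join i ≡ length (proj₂ p)
  blockSize-in p∈ i i∈ = trans (countB-cong (row-in p∈ i i∈)) (countB-memB _ (unique (proj₁ (validOf p∈))))

  join-InPiK : InPiK k join
  join-InPiK i with locate i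
  ... | inj₁ (p , p∈ , i∈) = trans (cong (_% k) (blockSize-in p∈ i i∈)) (length≡1 (proj₁ (validOf p∈)))
  ... | inj₂ i∉            = cong (_% k) (trans (countB-cong (row-out i i∉)) (countB-eqB′ i))

  join-upper : All (_⊑ join) (map proj₁ ps)
  join-upper = All.map⁺ (All.tabulate below)
    where
    below : ∀ {p} → p ∈ ps → proj₁ p ⊑ join
    below {x , L} p∈ i j xij with ιRel-elim L (trans (sym (proj₂ (validOf p∈) i j)) xij)
    ... | inj₁ refl        = joinRel-refl i
    ... | inj₂ (i∈L , j∈L) = trans (row-in p∈ i i∈L j) j∈L

  join-least : ∀ u → All (_⊑ u) (map proj₁ ps) → join ⊑ u
  join-least u ps⊑u i j ij with locate i
  ... | inj₁ (p , p∈ , i∈) =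
    All.lookup (All.map⁻ ps⊑u) p∈ i j
      (trans (proj₂ (validOf p∈) i j) (ιRel-block (proj₂ p) i∈ (trans (sym (row-in p∈ i i∈ j)) ij)))
  ... | inj₂ i∉ =
    subst (λ l → rel u i l ≡ true) (eqB⇒≡ (trans (sym (row-out i i∉ j)) ij)) (IsPartition.reflP (isPart u) i)

  join-unique : IsUniqueJoin k (map proj₁ ps) join
  join-unique =
      ( (join-InPiK , join-upper)
      , λ v (_ , ps⊑v) v⊑join i j → ≡true-ext (v⊑join i j) (join-least v ps⊑v i j))
    , λ u ((_ , ps⊑u) , u-min) i j → sym (u-min join (join-InPiK , join-upper) (join-least u ps⊑u) i j)

  -- Two disjoint blocks stay separate nontrivial blocks of the join.
  join-∉G : ∀ {p q} → p ∈ ps → q ∈ ps → Disjointᴮ (proj₂ p) (proj₂ q) → ¬ InG k join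
  join-∉G {p} {q} p∈ q∈ p∩q≡∅ (ini , _) =
    let a , b , a≢b , a∈ , b∈ = members-of p∈
        c , d , c≢d , c∈ , d∈ = members-of q∈
        nt-a = b , a≢b , trans (row-in p∈ a a∈ b) b∈
        nt-c = d , c≢d , trans (row-in q∈ c c∈ d) d∈
    in  not-¬ (InI⇒nontrivial-related join ini a c nt-a nt-c)
              (trans (row-in p∈ a a∈ c) (¬-not (λ c∈p → not-¬ c∈ (disjointᴮ-elim p∩q≡∅ c c∈p))))
    where
    members-of : ∀ {r} → r ∈ ps → TwoMembers (proj₂ r)
    members-of r∈ = let v = proj₁ (validOf r∈) in two-members _ (unique v) (2≤length v)

HasBlockIn : List (List (Fin m)) → Partition m → Set
HasBlockIn S x = Any (λ L → rel x ≈ᴿ ιRel L) S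

Proper : List (Fin m) → Set
Proper {m} L = Σ (Fin m) (λ c → memB c L ≡ false)

⊆ᴮ⇒⊑ : {x y : Partition m} {A B : List (Fin m)} →
       rel x ≈ᴿ ιRel A → rel y ≈ᴿ ιRel B → A ⊆ᴮ B → x ⊑ y
⊆ᴮ⇒⊑ {A = A} {B} x≈ιA y≈ιB A⊆B i j xij = trans (y≈ιB i j) (ιRel-mono (trans (sym (x≈ιA i j)) xij))
  where
  ιRel-mono : ιRel A i j ≡ true → ιRel B i j ≡ true
  ιRel-mono p with ιRel-elim A p
  ... | inj₁ refl        = ιRel-refl B i
  ... | inj₂ (i∈A , j∈A) = ιRel-block B (⊆ᴮ-elim A⊆B i i∈A) (⊆ᴮ-elim A⊆B j j∈A)

proper⇒¬IsMax : {x : Partition m} {L : List (Fin m)} →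
                rel x ≈ᴿ ιRel L → Proper L → 1 ≤ length L → ¬ IsMax x
proper⇒¬IsMax {x = x} {L} x≈ιL (c , c∉L) 1≤ x-max =
  let d , d∈L = memB-nonempty L 1≤
  in  not-¬ (trans (sym (x≈ιL c d)) (x-max c d)) (separated d d∈L)
  where
  separated : ∀ d → memB d L ≡ true → ιRel L c d ≡ false
  separated d d∈L rewrite c∉L with c ≟ d
  ... | yes refl = ⊥-elim (not-¬ d∈L c∉L)
  ... | no _     = refl

pairUp : {A B : Set} {P : A → B → Set} (xs : List A) → All (λ a → Σ B (P a)) xs →
         Σ (List (A × B)) (λ ps → map proj₁ ps ≡ xs × All (λ p → P (proj₁ p) (proj₂ p)) ps)
pairUp []       []              = [] , refl , []
pairUp (x ∷ xs) ((b , pxb) ∷ h) =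
  let ps , map≡ , hs = pairUp xs h in (x , b) ∷ ps , cong (x ∷_) map≡ , pxb ∷ hs

AllPairs-2≤ : {A : Set} {R : A → A → Set} {xs : List A} → 2 ≤ length xs → AllPairs R xs →
              Σ A (λ x → Σ A (λ y → x ∈ xs × y ∈ xs × R x y))
AllPairs-2≤ {xs = _ ∷ []}    (s≤s ()) _
AllPairs-2≤ {xs = x ∷ y ∷ _} _ ((Rxy ∷ _) ∷ _) = x , y , here refl , there (here refl) , Rxy

module FromLaminar (k : ℕ) .{{_ : NonZero k}} (S : List (List (Fin m)))
  (valid : All (ValidBlock k) S) (proper : ∀ {A} → A ∈ S → Proper A)
  (laminar : ∀ {A B} → A ∈ S → B ∈ S → NestedOrDisjoint A B) where

  BlockInS : PartitionBlock m → Set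
  BlockInS p = proj₂ p ∈ S × HasBlock p

  incomparable⇒disjoint : ∀ {p q} → BlockInS p → BlockInS q → Incomparable (proj₁ p) (proj₁ q) →
                          Disjointᴮ (proj₂ p) (proj₂ q)
  incomparable⇒disjoint {x , A} {y , B} (A∈S , x≈) (B∈S , y≈) (x⋢y , y⋢x) with laminar A∈S B∈S
  ... | inj₁ A⊆B        = ⊥-elim (x⋢y (⊆ᴮ⇒⊑ {x = x} {y} x≈ y≈ A⊆B))
  ... | inj₂ (inj₁ B⊆A) = ⊥-elim (y⋢x (⊆ᴮ⇒⊑ {x = y} {x} y≈ x≈ B⊆A))
  ... | inj₂ (inj₂ A∩B≡∅) = A∩B≡∅

  incomparables-disjoint : ∀ ps → All BlockInS ps → AllPairs Incomparable (map proj₁ ps) →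
                           AllPairs (λ p q → Disjointᴮ (proj₂ p) (proj₂ q)) ps
  incomparables-disjoint []       []       []           = []
  incomparables-disjoint (p ∷ ps) (b ∷ bs) (inc ∷ incs) =
      All.zipWith (λ {q} (c , p∥q) → incomparable⇒disjoint {p} {q} b c p∥q) (bs , All.map⁻ inc)
    ∷ incomparables-disjoint ps bs incs

  InN-fromLaminar : (N : List (Partition m)) → ¬ N ≡ [] → All (HasBlockIn S) N → InN k N
  InN-fromLaminar N N≢[] blocked =
    N≢[] , All.map (λ {x} → inG {x}) blocked , All.map (λ {x} → notMax {x}) blocked , joins
    where
    inG : ∀ {x} → HasBlockIn S x → InG k x
    inG {x} h with find h
    ... | L , L∈S , x≈ιL =
      let v = All.lookup valid L∈S in OneBlock.InG-oneBlock x L x≈ιL (unique v) k (2≤length v) (length≡1 v)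

    notMax : ∀ {x} → HasBlockIn S x → ¬ IsMax x
    notMax {x} h with find h
    ... | L , L∈S , x≈ιL =
      proper⇒¬IsMax {x = x} {L} x≈ιL (proper L∈S)
        (≤-trans (s≤s z≤n) (2≤length (All.lookup valid L∈S)))

    blockOf : ∀ {y} → y ∈ᴾ N → Σ (List (Fin m)) (λ L → L ∈ S × rel y ≈ᴿ ιRel L)
    blockOf {y} y∈N with find y∈N
    ... | x , x∈N , y≈x with find (All.lookup blocked x∈N)
    ...   | L , L∈S , x≈ιL = L , L∈S , λ i j → trans (y≈x i j) (x≈ιL i j)

    joins : ∀ xs → 2 ≤ length xs → All (_∈ᴾ N) xs → AllPairs Incomparable xs →
            Σ (Partition m) (λ j → IsUniqueJoin k xs j × ¬ InG k j)
    joins xs 2≤ xs∈N incomparable with pairUp xs (All.map (λ {y} → blockOf {y}) xs∈N)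
    ... | ps , refl , blocks =
      let disjoint = incomparables-disjoint ps blocks incomparable
          valid′ = All.map (λ (L∈S , y≈ιL) → All.lookup valid L∈S , y≈ιL) blocks
          open DisjointJoin k ps valid′ disjoint
          p , q , p∈ , q∈ , p∩q≡∅ =
            AllPairs-2≤ {xs = ps} (subst (2 ≤_) (length-map proj₁ ps) 2≤) disjoint
      in  join , join-unique , join-∉G p∈ q∈ p∩q≡∅

tree⇒InN : (k : ℕ) .{{_ : NonZero k}} (N : List (Partition m)) → ¬ N ≡ [] →
           (T : Tree m) → ValidTree k T → All (HasBlockIn (nonRootSets T)) N → InN k N
tree⇒InN k []      N≢[] _          _                           _           = ⊥-elim (N≢[] refl)
tree⇒InN k (_ ∷ _) _    (leaf _)   _                           (() ∷ _)
tree⇒InN {m} k N   N≢[] (node ts) (leaves↭ , 1<deg , _ , vs) blocked =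
  FromLaminar.InN-fromLaminar k (internalSetsL ts) (internalSetsL-valid k ts vs u)
    (internalSetsL-proper k ts 1<deg vs u) (internalSetsL-laminar ts u) N N≢[] blocked
  where
  u : Unique (leavesL ts)
  u = unique-↭ leaves↭ (Unique.allFin⁺ m)

¬all⇒proper : (L : List (Fin m)) → ¬ (∀ i → memB i L ≡ true) → Proper L
¬all⇒proper L ¬all with ⊆ᴮ? (allFin _) L
... | inj₁ all⊆L         = ⊥-elim (¬all λ i → ⊆ᴮ-elim all⊆L i (memB-allFin i))
... | inj₂ (c , _ , c∉L) = c , c∉L

OneBlockOf : (k : ℕ) .{{_ : NonZero k}} → Partition m → Set
OneBlockOf {m} k x = Σ (List (Fin m)) (λ L → (ValidBlock k L × Proper L) × rel x ≈ᴿ ιRel L)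

module _ (k : ℕ) .{{_ : NonZero k}} where

  InG⇒oneBlock : (x : Partition m) → InG k x → ¬ IsMax x → OneBlockOf k x
  InG⇒oneBlock x (ini , rk≡0) ¬max with InI⇒nontrivial x ini
  ... | r , nt-r = class , (validBlock uL 2≤ len≡1 , ¬all⇒proper class ¬all) , x≈ιL
    where
    open IsPartition (isPart x)
    open ClassOf x r
    uL = members-unique (rel x r)
    x≈ιL : rel x ≈ᴿ ιRel class
    x≈ιL i j = ≡true-ext to (classPart⊑ i j)
      where
      to : rel x i j ≡ true → ιRel class i j ≡ true
      to ij with i ≟ j
      ... | yes refl = refl
      ... | no i≢j   =
        let ri = InI⇒nontrivial-related x ini r i nt-r (j , i≢j , ij)
        in  ∧-intro (trans (memB-members (rel x r) i) ri) (trans (memB-members (rel x r) j) (transP r i j ri ij))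
    2≤ : 2 ≤ length class
    2≤ = subst (2 ≤_) (sym (length-members (rel x r))) (nontrivial⇒2≤blockSize x r nt-r)
    r∈class : memB r class ≡ true
    r∈class = trans (memB-members (rel x r) r) (reflP r)
    len≡1 : length class ≡[mod k ] 1
    len≡1 = subst (_≡[mod k ] 1) (trans (+-comm 1 _) (m∸n+n≡m (≤-trans (s≤s z≤n) 2≤)))
              (+-cong-≡[mod] {1} {length class ∸ 1} {1} {0} k refl
                (subst (_≡[mod k ] 0) (OneBlock.rk≡ x class x≈ιL uL r r∈class) rk≡0))
    ¬all : ¬ (∀ i → memB i class ≡ true)
    ¬all all∈ = ¬max λ i j → trans (x≈ιL i j) (ιRel-block class (all∈ i) (all∈ j))

  ⊑⇒⊆ᴮ : {x y : Partition m} {A B : List (Fin m)} →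
         rel x ≈ᴿ ιRel A → rel y ≈ᴿ ιRel B → ValidBlock k A → x ⊑ y → A ⊆ᴮ B
  ⊑⇒⊆ᴮ {x = x} {y} {A} {B} x≈ιA y≈ιB (validBlock uA 2≤ _) x⊑y = ⊆ᴮ-intro A⊆B
    where
    A⊆B : ∀ i → memB i A ≡ true → memB i B ≡ true
    A⊆B i i∈A with another-true (λ j → memB j A) i (subst (2 ≤_) (sym (countB-memB A uA)) 2≤)
    ... | i′ , i′≢i , i′∈A
      with ιRel-elim B (trans (sym (y≈ιB i i′)) (x⊑y i i′ (trans (x≈ιA i i′) (ιRel-block A i∈A i′∈A))))
    ... | inj₁ i≡i′      = ⊥-elim (i′≢i (sym i≡i′))
    ... | inj₂ (i∈B , _) = i∈B

  -- If the blocks of x and y meet in i, the class of i in a minimal upper bound j is a block of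
  -- size ≡ 1 mod k, so the partition with this single block is an upper bound below j, hence j.
  overlapping⇒minimalUpperBound∈G :
    {x y j : Partition m} {A B : List (Fin m)} → rel x ≈ᴿ ιRel A → rel y ≈ᴿ ιRel B → ValidBlock k A →
    MinimalUpperBound k (x ∷ y ∷ []) j → ∀ i → memB i A ≡ true → memB i B ≡ true → InG k j
  overlapping⇒minimalUpperBound∈G {x = x} {y} {j} {A} {B} x≈ιA y≈ιB (validBlock uA 2≤ _)
                                  ((j∈Πk , x⊑j ∷ y⊑j ∷ []) , j-minimal) i i∈A i∈B =
    InG-cong classPart j classPart≈j k (classPart∈G k j∈Πk 2≤blockSize)
    where
    open ClassOf j i
    2≤blockSize : 2 ≤ blockSize j i
    2≤blockSize with another-true (λ l → memB l A) i (subst (2 ≤_) (sym (countB-memB A uA)) 2≤)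
    ... | i′ , i′≢i , i′∈A = 2≤countB (rel j i) i i′ (IsPartition.reflP (isPart j) i)
      (x⊑j i i′ (trans (x≈ιA i i′) (ιRel-block A i∈A i′∈A))) (λ i≡i′ → i′≢i (sym i≡i′))
    classPart≈j : classPart ≈ j
    classPart≈j = j-minimal classPart
      (classPart∈Πk k j∈Πk , ⊑classPart {x} {A} x≈ιA i∈A x⊑j ∷ ⊑classPart {y} {B} y≈ιB i∈B y⊑j ∷ [])
      classPart⊑

  ∈⇒∈ᴾ : {x : Partition m} {N : List (Partition m)} → x ∈ N → x ∈ᴾ N
  ∈⇒∈ᴾ = Any.map λ { refl _ _ → refl }

  InN⇒nestedOrDisjoint : {N : List (Partition m)} → InN k N → {x y : Partition m} → x ∈ N → y ∈ N →
                         {A B : List (Fin m)} → ValidBlock k A → ValidBlock k B →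
                         rel x ≈ᴿ ιRel A → rel y ≈ᴿ ιRel B → NestedOrDisjoint A B
  InN⇒nestedOrDisjoint (_ , _ , _ , joins) {x} {y} x∈N y∈N {A} {B} vA vB x≈ιA y≈ιB
    with ⊆ᴮ? A B | ⊆ᴮ? B A
  ... | inj₁ A⊆B | _        = inj₁ A⊆B
  ... | inj₂ _   | inj₁ B⊆A = inj₂ (inj₁ B⊆A)
  ... | inj₂ (a , a∈A , a∉B) | inj₂ (b , b∈B , b∉A) =
    let j , ((j-mub , _) , j∉G) = joins (x ∷ y ∷ []) (s≤s (s≤s z≤n)) (∈⇒∈ᴾ x∈N ∷ ∈⇒∈ᴾ y∈N ∷ [])
                                        (((x⋢y , y⋢x) ∷ []) ∷ [] ∷ [])
    in  inj₂ (inj₂ (disjointᴮ-intro λ i i∈A → ¬-not λ i∈B →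
          j∉G (overlapping⇒minimalUpperBound∈G {x = x} {y} {j} {A} {B} x≈ιA y≈ιB vA j-mub i i∈A i∈B)))
    where
    x⋢y : ¬ x ⊑ y
    x⋢y x⊑y = not-¬ (⊆ᴮ-elim (⊑⇒⊆ᴮ {x = x} {y} {A} {B} x≈ιA y≈ιB vA x⊑y) a a∈A) a∉B
    y⋢x : ¬ y ⊑ x
    y⋢x y⊑x = not-¬ (⊆ᴮ-elim (⊑⇒⊆ᴮ {x = y} {x} {B} {A} y≈ιB x≈ιA vB y⊑x) b b∈B) b∉A

internalSets⊆internalSetsL : {ts : List (Tree m)} {t : Tree m} {A : List (Fin m)} →
                             t ∈ ts → A ∈ internalSets t → A ∈ internalSetsL ts
internalSets⊆internalSetsL {ts = t ∷ _} (here refl) p = ∈-++⁺ˡ p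
internalSets⊆internalSetsL {ts = t ∷ _} (there q)   p =
  ∈-++⁺ʳ (internalSets t) (internalSets⊆internalSetsL q p)

internalSetsL-∈⁻ : (ts : List (Tree m)) {A : List (Fin m)} → A ∈ internalSetsL ts →
                   Σ (Tree m) (λ t → t ∈ ts × A ∈ internalSets t)
internalSetsL-∈⁻ (t ∷ ts) p with ∈-++⁻ (internalSets t) p
... | inj₁ q = t , here refl , q
... | inj₂ q = let t′ , t′∈ , r = internalSetsL-∈⁻ ts q in t′ , there t′∈ , r

leavesL-∈⁻ : (ts : List (Tree m)) (i : Fin m) → memB i (leavesL ts) ≡ true →
             Σ (Tree m) (λ t → t ∈ ts × memB i (leaves t) ≡ true)
leavesL-∈⁻ (t ∷ ts) i p with memB-++⁻ i (leaves t) (leavesL ts) p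
... | inj₁ q = t , here refl , q
... | inj₂ q = let t′ , t′∈ , r = leavesL-∈⁻ ts i q in t′ , there t′∈ , r

leavesL-∈⁺ : {ts : List (Tree m)} {t : Tree m} (i : Fin m) → t ∈ ts → memB i (leaves t) ≡ true →
             memB i (leavesL ts) ≡ true
leavesL-∈⁺ {ts = t ∷ ts} i (here refl) p = memB-++⁺ˡ i (leaves t) (leavesL ts) p
leavesL-∈⁺ {ts = t ∷ ts} i (there q)   p = memB-++⁺ʳ i (leaves t) (leavesL ts) (leavesL-∈⁺ i q p)

leaves-unique : {ts : List (Tree m)} {t : Tree m} → t ∈ ts → Unique (leavesL ts) → Unique (leaves t)
leaves-unique {ts = t ∷ ts} (here refl) u = unique-++ˡ (leaves t) u
leaves-unique {ts = t ∷ ts} (there q)   u = leaves-unique q (unique-++ʳ (leaves t) u)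

leavesL-split-↭ : {P : Tree m → Set} (P? : ∀ t → Dec (P t)) (ts : List (Tree m)) →
                  leavesL ts ↭ leavesL (filter P? ts) ++ leavesL (filter (¬? ∘ P?) ts)
leavesL-split-↭ P? []       = ↭-refl
leavesL-split-↭ P? (t ∷ ts) with P? t
... | yes _ =
  subst (leaves t ++ leavesL ts ↭_) (sym (++-assoc (leaves t) _ _)) (++⁺ˡ (leaves t) (leavesL-split-↭ P? ts))
... | no _  = ↭-trans (++⁺ˡ (leaves t) (leavesL-split-↭ P? ts)) (shifts (leaves t) (leavesL (filter P? ts)))

module _ (k : ℕ) .{{_ : NonZero k}} where

  ValidDegL⇒All : (ts : List (Tree m)) → ValidDegL k ts → All (ValidDeg k) ts
  ValidDegL⇒All []       _        = []
  ValidDegL⇒All (t ∷ ts) (v , vs) = v ∷ ValidDegL⇒All ts vs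

  All⇒ValidDegL : (ts : List (Tree m)) → All (ValidDeg k) ts → ValidDegL k ts
  All⇒ValidDegL []       _        = tt
  All⇒ValidDegL (t ∷ ts) (v ∷ vs) = v , All⇒ValidDegL ts vs

  leafForest-validDeg : (xs : List (Fin m)) → ValidDegL k (map leaf xs)
  leafForest-validDeg []       = tt
  leafForest-validDeg (x ∷ xs) = tt , leafForest-validDeg xs

leafForest-leaves : (xs : List (Fin m)) → leavesL (map leaf xs) ≡ xs
leafForest-leaves []       = refl
leafForest-leaves (x ∷ xs) = cong (x ∷_) (leafForest-leaves xs)

leafForest-internalSets : (xs : List (Fin m)) {A : List (Fin m)} → A ∉ internalSetsL (map leaf xs)
leafForest-internalSets (x ∷ xs) A∈ = leafForest-internalSets xs A∈

-- Inserting S into a forest on all leaves gathers the trees whose leaves lie in S under a new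
-- vertex; by laminarity every other tree is disjoint from S.
module Build (k : ℕ) .{{_ : NonZero k}} (Ls : List (List (Fin m)))
  (valid : ∀ {L} → L ∈ Ls → ValidBlock k L × Proper L)
  (laminar : ∀ {A B} → A ∈ Ls → B ∈ Ls → NestedOrDisjoint A B) where

  Listed : List (List (Fin m)) → Set
  Listed As = ∀ {A} → A ∈ As → Σ (List (Fin m)) (λ L → L ∈ Ls × A ≐ L)

  Covers : List (List (Fin m)) → List (Fin m) → Set
  Covers As L = Σ (List (Fin m)) (λ A → A ∈ As × L ≐ A)

  record Forest (s : ℕ) (F : List (Tree m)) : Set where
    field
      leaves↭    : leavesL F ↭ allFin m
      validDeg   : ValidDegL k F
      listed     : Listed (internalSetsL F)
      size-bound : ∀ {A} → A ∈ internalSetsL F → length A ≤ s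

    unique-leaves : Unique (leavesL F)
    unique-leaves = unique-↭ leaves↭ (Unique.allFin⁺ m)

    all-leaves : ∀ i → memB i (leavesL F) ≡ true
    all-leaves i = ∈⇒memB (∈-resp-↭ (↭-sym leaves↭) (∈-allFin i))

  _⊆ˢ_ : List (Tree m) → List (Tree m) → Set
  F ⊆ˢ F′ = ∀ {A} → A ∈ internalSetsL F → A ∈ internalSetsL F′

  Insertion : ℕ → List (Tree m) → List (Fin m) → Set
  Insertion s F S = Σ (List (Tree m)) (λ F′ → Forest s F′ × Covers (internalSetsL F′) S × F ⊆ˢ F′)

  module Insert (s : ℕ) (F : List (Tree m)) (forest : Forest s F)
                (S : List (Fin m)) (S∈Ls : S ∈ Ls) (|S|≡s : length S ≡ s) where
    open Forest forest

    open ValidBlock (proj₁ (valid S∈Ls)) renaming (unique to uS; 2≤length to 2≤|S|; length≡1 to |S|≡1)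

    tree-above? : (ts : List (Tree m)) → Σ (Tree m) (λ t → t ∈ ts × S ⊆ᴮ leaves t)
                  ⊎ (∀ {t} → t ∈ ts → Σ (Fin m) (λ i → memB i S ≡ true × memB i (leaves t) ≡ false))
    tree-above? []       = inj₂ λ ()
    tree-above? (t ∷ ts) with ⊆ᴮ? S (leaves t) | tree-above? ts
    ... | inj₁ S⊆t | _                     = inj₁ (t , here refl , S⊆t)
    ... | inj₂ _   | inj₁ (t′ , t′∈ , S⊆t′) = inj₁ (t′ , there t′∈ , S⊆t′)
    ... | inj₂ w   | inj₂ ws               = inj₂ λ { (here refl) → w ; (there q) → ws q }

    -- A tree above S has at most s leaves, so its leaf set is S itself.
    already-covered : ∀ {t} → t ∈ F → S ⊆ᴮ leaves t → Insertion s F S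
    already-covered {leaf j} _ S⊆j =
      let a , b , a≢b , a∈S , b∈S = two-members S uS 2≤|S|
      in  ⊥-elim (a≢b (trans memB-[ ⊆ᴮ-elim S⊆j a a∈S ] (sym memB-[ ⊆ᴮ-elim S⊆j b b∈S ])))
    already-covered {node cs} t∈F S⊆t =
      F , forest , (leavesL cs , t-set , ⊆ᴮ-antisym S⊆t t⊆S) , λ A∈ → A∈
      where
      t-set : leavesL cs ∈ internalSetsL F
      t-set = internalSets⊆internalSetsL t∈F (here refl)
      t⊆S : leavesL cs ⊆ᴮ S
      t⊆S = ⊆ᴮ∧length≤⇒⊇ᴮ uS (leaves-unique t∈F unique-leaves) S⊆t
              (subst (length (leavesL cs) ≤_) (sym |S|≡s) (size-bound t-set))

    module Gather
      (none-above : ∀ {t} → t ∈ F → Σ (Fin m) (λ i → memB i S ≡ true × memB i (leaves t) ≡ false)) where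

      Inside : Tree m → Set
      Inside t = leaves t ⊆ᴮ S

      inside? : ∀ t → Dec (Inside t)
      inside? t = ⊆ᴮ-dec (leaves t) S

      I O : List (Tree m)
      I = filter inside? F
      O = filter (¬? ∘ inside?) F

      I⊆F : ∀ {t} → t ∈ I → t ∈ F × Inside t
      I⊆F = ∈-filter⁻ inside? {xs = F}

      O⊆F : ∀ {t} → t ∈ O → t ∈ F
      O⊆F = proj₁ ∘ ∈-filter⁻ (¬? ∘ inside?) {xs = F}

      outside-disjoint : ∀ {t} → t ∈ F → ¬ Inside t → Disjointᴮ (leaves t) S
      outside-disjoint {leaf j} t∈F t⊈S =
        let i , i∈t , i∉S = ¬⊆ᴮ⇒witness (leaves (leaf j)) S t⊈S
        in  disjointᴮ-intro λ l l∈t →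
              subst (λ z → memB z S ≡ false) (trans memB-[ i∈t ] (sym memB-[ l∈t ])) i∉S
      outside-disjoint {node cs} t∈F t⊈S with ¬⊆ᴮ⇒witness (leavesL cs) S t⊈S
                                            | listed (internalSets⊆internalSetsL t∈F (here refl))
      ... | i , i∈t , i∉S | L , L∈Ls , t≐L with laminar L∈Ls S∈Ls
      ...   | inj₁ L⊆S = ⊥-elim (not-¬ (⊆ᴮ-elim L⊆S i (trans (sym (≐-elim t≐L i)) i∈t)) i∉S)
      ...   | inj₂ (inj₁ S⊆L) = let w , w∈S , w∉t = none-above t∈F
                                in  ⊥-elim (not-¬ (trans (≐-elim t≐L w) (⊆ᴮ-elim S⊆L w w∈S)) w∉t)
      ...   | inj₂ (inj₂ L∩S≡∅) =
        disjointᴮ-intro λ l l∈t → disjointᴮ-elim L∩S≡∅ l (trans (sym (≐-elim t≐L l)) l∈t)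

      I≐S : leavesL I ≐ S
      I≐S = ⊆ᴮ-antisym (⊆ᴮ-intro I⊆S) (⊆ᴮ-intro S⊆I)
        where
        I⊆S : ∀ i → memB i (leavesL I) ≡ true → memB i S ≡ true
        I⊆S i p = let t , t∈I , i∈t = leavesL-∈⁻ I i p in ⊆ᴮ-elim (proj₂ (I⊆F t∈I)) i i∈t
        S⊆I : ∀ i → memB i S ≡ true → memB i (leavesL I) ≡ true
        S⊆I i i∈S with leavesL-∈⁻ F i (all-leaves i)
        ... | t , t∈F , i∈t with inside? t
        ...   | yes t⊆S = leavesL-∈⁺ i (∈-filter⁺ inside? t∈F t⊆S) i∈t
        ...   | no t⊈S  = ⊥-elim (not-¬ i∈S (disjointᴮ-elim (outside-disjoint t∈F t⊈S) i i∈t))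

      F′ : List (Tree m)
      F′ = node I ∷ O

      leaves↭′ : leavesL F′ ↭ allFin m
      leaves↭′ = ↭-trans (↭-sym (leavesL-split-↭ inside? F)) leaves↭

      |I|≡s : length (leavesL I) ≡ s
      |I|≡s = trans (≐⇒length≡ uI uS I≐S) |S|≡s
        where
        uI : Unique (leavesL I)
        uI = unique-++ˡ (leavesL I) (unique-↭ leaves↭′ (Unique.allFin⁺ m))

      validDeg-I : ValidDegL k I
      validDeg-I = All⇒ValidDegL k I (All.filter⁺ inside? (ValidDegL⇒All k F validDeg))

      validDeg-O : ValidDegL k O
      validDeg-O = All⇒ValidDegL k O (All.filter⁺ (¬? ∘ inside?) (ValidDegL⇒All k F validDeg))

      1<|I| : 1 < length I
      1<|I| = several I (⊆ᴮ-intro λ i i∈S → trans (≐-elim I≐S i) i∈S) (proj₁ ∘ I⊆F)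
        where
        several : ∀ J → S ⊆ᴮ leavesL J → (∀ {t} → t ∈ J → t ∈ F) → 1 < length J
        several []            S⊆J _  = let a , a∈S = memB-nonempty S (≤-trans (s≤s z≤n) 2≤|S|)
                                       in  ⊥-elim (not-¬ (⊆ᴮ-elim S⊆J a a∈S) refl)
        several (t ∷ [])      S⊆J J⊆F =
          let w , w∈S , w∉t = none-above (J⊆F (here refl))
          in  ⊥-elim (not-¬ (trans (sym (memB-++ w (leaves t) [])) (⊆ᴮ-elim S⊆J w w∈S)) (cong (_∨ false) w∉t))
        several (_ ∷ _ ∷ _)   _   _  = s≤s (s≤s z≤n)

      |I|≡1 : length I ≡[mod k ] 1
      |I|≡1 = trans (sym (proj₂ (leavesL-length k I validDeg-I)))
                    (trans (cong (_% k) (trans |I|≡s (sym |S|≡s))) |S|≡1)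

      from-F : ∀ {A} → A ∈ internalSetsL I ++ internalSetsL O → A ∈ internalSetsL F
      from-F p with ∈-++⁻ (internalSetsL I) p
      ... | inj₁ q =
        let t , t∈I , r = internalSetsL-∈⁻ I q in internalSets⊆internalSetsL (proj₁ (I⊆F t∈I)) r
      ... | inj₂ q =
        let t , t∈O , r = internalSetsL-∈⁻ O q in internalSets⊆internalSetsL (O⊆F t∈O) r

      forest′ : Forest s F′
      forest′ = record
        { leaves↭    = leaves↭′
        ; validDeg   = (1<|I| , |I|≡1 , validDeg-I) , validDeg-O
        ; listed     = λ { (here refl) → S , S∈Ls , I≐S ; (there p) → listed (from-F p) }
        ; size-bound = λ { (here refl) → ≤-reflexive |I|≡s ; (there p) → size-bound (from-F p) }
        }

      F⊆ˢF′ : F ⊆ˢ F′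
      F⊆ˢF′ p with internalSetsL-∈⁻ F p
      ... | t , t∈F , q with inside? t
      ...   | yes t⊆S = there (∈-++⁺ˡ (internalSets⊆internalSetsL (∈-filter⁺ inside? t∈F t⊆S) q))
      ...   | no t⊈S  =
        there (∈-++⁺ʳ (internalSetsL I) (internalSets⊆internalSetsL (∈-filter⁺ (¬? ∘ inside?) t∈F t⊈S) q))

      gathered : Insertion s F S
      gathered = F′ , forest′ , (leavesL I , here refl , ≐-sym I≐S) , F⊆ˢF′

    insert : Insertion s F S
    insert with tree-above? F
    ... | inj₁ (t , t∈F , S⊆t) = already-covered t∈F S⊆t
    ... | inj₂ none-above      = Gather.gathered none-above

  insertAll : ∀ s (R : List (List (Fin m))) F → Forest s F → (∀ {L} → L ∈ R → L ∈ Ls) →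
              Σ (List (Tree m)) (λ F′ → Forest s F′
                × (∀ {L} → L ∈ R → length L ≡ s → Covers (internalSetsL F′) L) × F ⊆ˢ F′)
  insertAll s []      F forest _    = F , forest , (λ ()) , λ A∈ → A∈
  insertAll s (L ∷ R) F forest R⊆Ls with length L ℕ.≟ s
  ... | yes |L|≡s =
    let F₁ , forest₁ , covers-L , F⊆F₁ = Insert.insert s F forest L (R⊆Ls (here refl)) |L|≡s
        F₂ , forest₂ , covers-R , F₁⊆F₂ = insertAll s R F₁ forest₁ (R⊆Ls ∘ there)
        (A , A∈ , L≐A) = covers-L
    in  F₂ , forest₂ , (λ { (here refl) _ → A , F₁⊆F₂ A∈ , L≐A ; (there q) → covers-R q }) , F₁⊆F₂ ∘ F⊆F₁
  ... | no |L|≢s =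
    let F₂ , forest₂ , covers-R , F⊆F₂ = insertAll s R F forest (R⊆Ls ∘ there)
    in  F₂ , forest₂ , (λ { (here refl) |L|≡s → ⊥-elim (|L|≢s |L|≡s) ; (there q) → covers-R q }) , F⊆F₂

  Forest-suc : ∀ {s F} → Forest s F → Forest (suc s) F
  Forest-suc forest = record
    { leaves↭ = leaves↭ ; validDeg = validDeg ; listed = listed ; size-bound = m≤n⇒m≤1+n ∘ size-bound }
    where open Forest forest

  leafForest : Forest 0 (map leaf (allFin m))
  leafForest = record
    { leaves↭    = subst (_↭ allFin m) (sym (leafForest-leaves (allFin m))) ↭-refl
    ; validDeg   = leafForest-validDeg k (allFin m)
    ; listed     = ⊥-elim ∘ leafForest-internalSets (allFin m)
    ; size-bound = ⊥-elim ∘ leafForest-internalSets (allFin m)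
    }

  stage : ∀ s → Σ (List (Tree m)) (λ F → Forest s F
                × (∀ {L} → L ∈ Ls → length L < s → Covers (internalSetsL F) L))
  stage zero    = map leaf (allFin m) , leafForest , λ _ ()
  stage (suc s) with stage s
  ... | F , forest , covers with insertAll s Ls F forest (λ L∈ → L∈)
  ...   | F′ , forest′ , covers-s , F⊆F′ = F′ , Forest-suc forest′ , covers′
    where
    covers′ : ∀ {L} → L ∈ Ls → length L < suc s → Covers (internalSetsL F′) L
    covers′ L∈ |L|<1+s with m≤n⇒m<n∨m≡n (ℕ.s≤s⁻¹ |L|<1+s)
    ... | inj₁ |L|<s = let A , A∈ , L≐A = covers L∈ |L|<s in A , F⊆F′ A∈ , L≐A
    ... | inj₂ |L|≡s = covers-s L∈ |L|≡s

  tree : m ≡[mod k ] 1 → ∀ {L₀} → L₀ ∈ Ls →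
         Σ (Tree m) (λ T → ValidTree k T
           × Listed (nonRootSets T) × (∀ {L} → L ∈ Ls → Covers (nonRootSets T) L))
  tree m≡1 {L₀} L₀∈ =
    let F , forest , covers = stage (suc m)
        open Forest forest
    in  node F , (leaves↭ , root-degree F leaves↭ listed , |F|≡1 F forest , validDeg) , listed
      , λ L∈ → covers L∈ (s≤s (length≤ _ (unique (proj₁ (valid L∈)))))
    where
    |leaves|≡m : ∀ {xs : List (Fin m)} → xs ↭ allFin m → length xs ≡ m
    |leaves|≡m xs↭ = trans (↭-length xs↭) (length-tabulate (λ i → i))
    2≤m : 2 ≤ m
    2≤m = let v = proj₁ (valid L₀∈) in ≤-trans (2≤length v) (length≤ L₀ (unique v))
    too-few : ∀ {xs} → xs ↭ allFin m → length xs < 2 → ⊥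
    too-few xs↭ |xs|<2 = <⇒≱ |xs|<2 (subst (2 ≤_) (sym (|leaves|≡m xs↭)) 2≤m)
    |F|≡1 : ∀ F → Forest (suc m) F → length F ≡[mod k ] 1
    |F|≡1 F forest = let open Forest forest in
      trans (sym (proj₂ (leavesL-length k F validDeg))) (trans (cong (_% k) (|leaves|≡m leaves↭)) m≡1)
    -- A single child would be a listed set containing every leaf, but listed sets are proper.
    root-degree : ∀ F → leavesL F ↭ allFin m → Listed (internalSetsL F) → 1 < length F
    root-degree []             F↭ _      = ⊥-elim (too-few F↭ (s≤s z≤n))
    root-degree (leaf i ∷ [])  F↭ _      = ⊥-elim (too-few F↭ (s≤s (s≤s z≤n)))
    root-degree (node cs ∷ []) F↭ listed with listed (here refl)
    ... | L , L∈ , cs≐L =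
      let c , c∉L = proj₂ (valid L∈)
          c∈cs = trans (sym (∨-identityʳ (memB c (leavesL cs)))) (trans (sym (memB-++ c (leavesL cs) []))
                   (∈⇒memB (∈-resp-↭ (↭-sym F↭) (∈-allFin c))))
      in  ⊥-elim (not-¬ (trans (sym (≐-elim cs≐L c)) c∈cs) c∉L)
    root-degree (_ ∷ _ ∷ _)    _  _      = s≤s (s≤s z≤n)

TreeFor : (k : ℕ) .{{_ : NonZero k}} → List (Partition m) → Set
TreeFor {m} k N = Σ (Tree m) (λ T → ValidTree k T
  × All (HasBlockIn (nonRootSets T)) N
  × All (λ L → Any (λ x → rel x ≈ᴿ ιRel L) N) (nonRootSets T))

module FromInN (k : ℕ) .{{_ : NonZero k}} (m≡1 : m ≡[mod k ] 1) (ps : List (PartitionBlock m))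
  (blocks : All (λ p → (ValidBlock k (proj₂ p) × Proper (proj₂ p)) × HasBlock p) ps)
  (inN : InN k (map proj₁ ps)) where

  Ls : List (List (Fin m))
  Ls = map proj₂ ps

  blockOf : ∀ {p} → p ∈ ps → (ValidBlock k (proj₂ p) × Proper (proj₂ p)) × HasBlock p
  blockOf = All.lookup blocks

  valid : ∀ {L} → L ∈ Ls → ValidBlock k L × Proper L
  valid L∈ with ∈-map⁻ proj₂ L∈
  ... | p , p∈ , refl = proj₁ (blockOf p∈)

  laminar : ∀ {A B} → A ∈ Ls → B ∈ Ls → NestedOrDisjoint A B
  laminar A∈ B∈ with ∈-map⁻ proj₂ A∈ | ∈-map⁻ proj₂ B∈
  ... | p , p∈ , refl | q , q∈ , refl =
    InN⇒nestedOrDisjoint k inN (∈-map⁺ proj₁ p∈) (∈-map⁺ proj₁ q∈)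
      (proj₁ (proj₁ (blockOf p∈))) (proj₁ (proj₁ (blockOf q∈))) (proj₂ (blockOf p∈)) (proj₂ (blockOf q∈))

  some-block : Σ (List (Fin m)) (_∈ Ls)
  some-block = first ps (proj₁ inN)
    where
    first : ∀ qs → ¬ map proj₁ qs ≡ [] → Σ (List (Fin m)) (_∈ map proj₂ qs)
    first []      qs≢[] = ⊥-elim (qs≢[] refl)
    first (q ∷ _) _     = proj₂ q , here refl

  treeFor : TreeFor k (map proj₁ ps)
  treeFor with Build.tree k Ls valid laminar m≡1 (proj₂ some-block)
  ... | T , validT , listed , covers = T , validT , All.map⁺ (All.tabulate N⊆T) , All.tabulate T⊆N
    where
    N⊆T : ∀ {p} → p ∈ ps → HasBlockIn (nonRootSets T) (proj₁ p)
    N⊆T p∈ = let A , A∈ , L≐A = covers (∈-map⁺ proj₂ p∈)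
             in  lose A∈ λ i j → trans (proj₂ (blockOf p∈) i j) (ιRel-≐ L≐A i j)
    T⊆N : ∀ {A} → A ∈ nonRootSets T → Any (λ x → rel x ≈ᴿ ιRel A) (map proj₁ ps)
    T⊆N A∈ with listed A∈
    ... | L , L∈ , A≐L with ∈-map⁻ proj₂ L∈
    ...   | p , p∈ , refl =
      lose (∈-map⁺ proj₁ p∈) λ i j → trans (proj₂ (blockOf p∈) i j) (ιRel-≐ (≐-sym A≐L) i j)

InN⇒tree : (k : ℕ) .{{_ : NonZero k}} → m ≡[mod k ] 1 → (N : List (Partition m)) → InN k N → TreeFor k N
InN⇒tree k m≡1 N inN@(_ , N⊆G , N-notMax , _)
  with pairUp N (All.zipWith (λ {x} (x∈G , ¬max) → InG⇒oneBlock k x x∈G ¬max) (N⊆G , N-notMax))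
... | ps , refl , blocks = FromInN.treeFor k m≡1 ps blocks inN

mainTheorem4 : (k n : ℕ) → .{{_ : NonZero k}} → 1 ≤ n →
    (N : List (Partition ((n ∸ 1) * k + 1))) →
    InN k N ⇔
      (¬ (N ≡ []) × Σ (Tree ((n ∸ 1) * k + 1)) (λ T → ValidTree k T
        × All (λ x → Any (λ L → rel x ≈ᴿ ιRel L) (nonRootSets T)) N
        × All (λ L → Any (λ x → rel x ≈ᴿ ιRel L) N) (nonRootSets T)))
mainTheorem4 k n _ N = mk⇔
  (λ inN → proj₁ inN , InN⇒tree k m≡1 N inN)
  (λ (N≢[] , T , validT , N⊆T , _) → tree⇒InN k N N≢[] T validT N⊆T)
  where
  m≡1 : ((n ∸ 1) * k + 1) ≡[mod k ] 1
  m≡1 = trans (cong (_% k) (+-comm ((n ∸ 1) * k) 1)) ([m+kn]%n≡m%n 1 (n ∸ 1) k)
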